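{- Let $\mathcal{J}(m,n)$ be the number of 02-partitions of $n$ of length $m$. Then, as formal power series in $z$ and $q$, $$\sum_{m,n\geq 0}\mathcal{J}(m,n)\, z^m q^n = \frac{(z^3q^6;q^3)_\infty}{(zq^2;q)_\infty\,(z^2q^2;q)_\infty}.$$
   Context: A 02-partition of a non-negative integer $n$ of length $m$ is a sequence $(n_1,\dots,n_m)$ of non-negative integers with $\sum_i n_i = n$, last entry $n_m \geq 2$ (when $m\ge1$), and $n_j \geq n_{j+1}-2$, $n_j \geq n_{j+2}$ whenever the indices are in range. The empty sequence is the unique 02-partition of length $0$ (of $n=0$). Notation: $(a;q)_\infty = \prod_{i\ge0}(1-aq^i)$. -}

module Defs where

open import Data.Nat as ℕ using (ℕ; zero; suc; _≤_; _∸_)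
open import Data.Integer as ℤ using (ℤ; +_)
open import Data.List using (List; []; _∷_; length)
open import Data.Nat.ListAction using (sum)
open import Data.Product using (Σ-syntax; _×_)
open import Data.Unit using (⊤)
open import Data.Bool using (Bool; true; false; if_then_else_)
open import Relation.Nullary.Decidable using (⌊_⌋; _×-dec_)
open import Relation.Binary.PropositionalEquality using (_≡_)

Cond02 : List ℕ → Set
Cond02 [] = ⊤
Cond02 (a ∷ []) = 2 ≤ a
Cond02 (a ∷ b ∷ []) = (b ≤ a ℕ.+ 2) × (2 ≤ b)
Cond02 (a ∷ b ∷ c ∷ rest) = (b ≤ a ℕ.+ 2) × (c ≤ a) × Cond02 (b ∷ c ∷ rest)

Part02 : ℕ → ℕ → Set
Part02 m n = Σ[ l ∈ List ℕ ] ((length l ≡ m) × (sum l ≡ n) × Cond02 l)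

-- Formal power series in z and q with integer coefficients:
-- s m n = coefficient of z^m q^n.

Series : Set
Series = ℕ → ℕ → ℤ

Σ≤ : ℕ → (ℕ → ℤ) → ℤ
Σ≤ zero f = f 0
Σ≤ (suc n) f = Σ≤ n f ℤ.+ f (suc n)

_⊛_ : Series → Series → Series
(f ⊛ g) m n = Σ≤ m λ i → Σ≤ n λ j → f i j ℤ.* g (m ∸ i) (n ∸ j)

infixl 7 _⊛_

[_] : Bool → ℤ
[ b ] = if b then + 1 else + 0

𝟙 : Series
𝟙 m n = [ ⌊ (m ℕ.≟ 0) ×-dec (n ℕ.≟ 0) ⌋ ]

oneMinus : ℕ → ℕ → Series
oneMinus a b m n = 𝟙 m n ℤ.- [ ⌊ (m ℕ.≟ a) ×-dec (n ℕ.≟ b) ⌋ ]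

-- the formal inverse 1/(1 - z^a q^b) = Σ_k z^{ak} q^{bk}  (valid for b ≥ 1)
geom : ℕ → ℕ → Series
geom a b m n = Σ≤ n λ k → [ ⌊ (m ℕ.≟ a ℕ.* k) ×-dec (n ℕ.≟ b ℕ.* k) ⌋ ]

∏< : ℕ → (ℕ → Series) → Series
∏< zero f = 𝟙
∏< (suc N) f = ∏< N f ⊛ f N

-- All omitted factors are ≡ 1 mod q^{N+2}, so coefficients of q^n with
-- n ≤ N agree with those of the infinite product.
rhsTrunc : ℕ → Series
rhsTrunc N =
  (∏< N λ i → oneMinus 3 (6 ℕ.+ 3 ℕ.* i))
  ⊛ ((∏< N λ i → geom 1 (2 ℕ.+ i)) ⊛ (∏< N λ i → geom 2 (2 ℕ.+ i)))

{-# OPTIONS --safe #-}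
-- Read a 02-partition backwards, from its last entry.  Which entry may come next depends only on
-- two lower bounds (l₁, l₂), so the generating functions F l₁ l₂ of such tails satisfy
--   F l₁ l₂ (z) = z q^l₁ F (max l₂ (l₁ - 2)) l₁ (z) + F (l₁ + 1) l₂ (z)   (is the next entry l₁?)
--   F (l₁ + 1) (l₂ + 1) (z) = F l₁ l₂ (z q)                              (subtract 1 everywhere).
-- For G = F 2 0 and the series F 0 2, F 0 1, F 1 0, F 0 0 these close up into a linear system,
-- and eliminating the other four series gives
--   (1 - z q²) (1 - z² q²) (1 - z² q³) G(z) = (1 - z³ q⁶) G(z q).
-- The product side satisfies the same equation, because each of its three products telescopes
-- under z ↦ z q.  Both series are 1 modulo z, which pins the solution down: once the coefficients
-- of lower powers of z agree, the coefficient of z^m q^n of the equation relates the difference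
-- at (m, n) to the difference at (m, n - m).  Truncating the products after N factors does not
-- change coefficients of q-degree at most N.
module Submission where

open import Defs
open import Data.Nat as ℕ using (ℕ; zero; suc; _+_; _∸_; _⊔_; _≤_; _<_; z≤n; s≤s; pred; _≤?_)
import Data.Nat.Properties as ℕₚ
open import Data.Nat.Induction using (<-rec)
open import Data.Nat.ListAction using (sum)
import Data.Nat.ListAction.Properties as Sumₚ
open import Data.Integer as ℤ using (ℤ; +_; 0ℤ)
import Data.Integer.Properties as ℤₚ
open import Data.Bool using (true; false; if_then_else_)
open import Data.Empty using (⊥; ⊥-elim)
open import Data.Unit using (⊤; tt)
open import Data.Product using (Σ; Σ-syntax; _×_; _,_; proj₁; proj₂)
open import Data.Sum using (_⊎_; inj₁; inj₂)
open import Data.Sum.Function.Propositional using (_⊎-↔_)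
open import Data.Maybe using (Maybe; just; nothing)
open import Data.List using (List; []; _∷_; _∷ʳ_; length; map; reverse)
import Data.List.Properties as Listₚ
open import Data.List.Relation.Binary.Permutation.Propositional.Properties using (↭-reverse)
open import Data.Fin using (Fin)
import Data.Fin.Properties as Finₚ
open import Data.Fin.Permutation using (↔⇒≡)
open import Function.Base using (_∘_)
open import Function.Bundles using (_↔_; mk↔ₛ′)
open import Function.Properties.Inverse using (↔-refl; ↔-trans; ↔-sym)
open import Relation.Nullary using (¬_; Dec; yes; no)
open import Relation.Nullary.Decidable using (⌊_⌋; _×-dec_)
open import Relation.Nullary.Irrelevant using (Irrelevant)
open import Relation.Binary.PropositionalEquality hiding ([_])
open import Algebra.Bundles using (CommutativeRing)
open import Algebra.Structures using (IsCommutativeRing)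
open import Algebra.Solver.Ring.AlmostCommutativeRing using (fromCommutativeRing; _-Raw-AlmostCommutative⟶_)
import Algebra.Solver.Ring as RingSolver
open import Algebra.Properties.CommutativeSemigroup ℤₚ.+-commutativeSemigroup
  using () renaming (interchange to +-interchange)

open ≡-Reasoning

Σ≤-cong : ∀ n {f g : ℕ → ℤ} → (∀ i → f i ≡ g i) → Σ≤ n f ≡ Σ≤ n g
Σ≤-cong zero f≡g = f≡g 0
Σ≤-cong (suc n) f≡g = cong₂ ℤ._+_ (Σ≤-cong n f≡g) (f≡g (suc n))

Σ≤-cong≤ : ∀ n {f g : ℕ → ℤ} → (∀ i → i ≤ n → f i ≡ g i) → Σ≤ n f ≡ Σ≤ n g
Σ≤-cong≤ zero f≡g = f≡g 0 z≤n
Σ≤-cong≤ (suc n) f≡g =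
  cong₂ ℤ._+_ (Σ≤-cong≤ n (λ i i≤n → f≡g i (ℕₚ.m≤n⇒m≤1+n i≤n))) (f≡g (suc n) ℕₚ.≤-refl)

Σ≤-zero : ∀ n {f : ℕ → ℤ} → (∀ i → i ≤ n → f i ≡ 0ℤ) → Σ≤ n f ≡ 0ℤ
Σ≤-zero n f≡0 = trans (Σ≤-cong≤ n f≡0) (Σ≤-const0 n)
  where
  Σ≤-const0 : ∀ n → Σ≤ n (λ _ → 0ℤ) ≡ 0ℤ
  Σ≤-const0 zero = refl
  Σ≤-const0 (suc n) = cong (ℤ._+ 0ℤ) (Σ≤-const0 n)

Σ≤-distrib-+ : ∀ n (f g : ℕ → ℤ) → Σ≤ n (λ i → f i ℤ.+ g i) ≡ Σ≤ n f ℤ.+ Σ≤ n g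
Σ≤-distrib-+ zero f g = refl
Σ≤-distrib-+ (suc n) f g = begin
  Σ≤ n (λ i → f i ℤ.+ g i) ℤ.+ (f (suc n) ℤ.+ g (suc n))
    ≡⟨ cong (ℤ._+ (f (suc n) ℤ.+ g (suc n))) (Σ≤-distrib-+ n f g) ⟩
  (Σ≤ n f ℤ.+ Σ≤ n g) ℤ.+ (f (suc n) ℤ.+ g (suc n))
    ≡⟨ +-interchange (Σ≤ n f) (Σ≤ n g) (f (suc n)) (g (suc n)) ⟩
  (Σ≤ n f ℤ.+ f (suc n)) ℤ.+ (Σ≤ n g ℤ.+ g (suc n)) ∎

Σ≤-*ˡ : ∀ n c (f : ℕ → ℤ) → Σ≤ n (λ i → c ℤ.* f i) ≡ c ℤ.* Σ≤ n f
Σ≤-*ˡ zero c f = refl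
Σ≤-*ˡ (suc n) c f =
  trans (cong (ℤ._+ (c ℤ.* f (suc n))) (Σ≤-*ˡ n c f)) (sym (ℤₚ.*-distribˡ-+ c (Σ≤ n f) (f (suc n))))

Σ≤-*ʳ : ∀ n c (f : ℕ → ℤ) → Σ≤ n (λ i → f i ℤ.* c) ≡ Σ≤ n f ℤ.* c
Σ≤-*ʳ n c f = begin
  Σ≤ n (λ i → f i ℤ.* c) ≡⟨ Σ≤-cong n (λ i → ℤₚ.*-comm (f i) c) ⟩
  Σ≤ n (λ i → c ℤ.* f i) ≡⟨ Σ≤-*ˡ n c f ⟩
  c ℤ.* Σ≤ n f           ≡⟨ ℤₚ.*-comm c (Σ≤ n f) ⟩
  Σ≤ n f ℤ.* c           ∎

Σ≤-neg : ∀ n (f : ℕ → ℤ) → Σ≤ n (λ i → ℤ.- f i) ≡ ℤ.- Σ≤ n f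
Σ≤-neg zero f = refl
Σ≤-neg (suc n) f =
  trans (cong (ℤ._+ (ℤ.- f (suc n))) (Σ≤-neg n f)) (sym (ℤₚ.neg-distrib-+ (Σ≤ n f) (f (suc n))))

Σ≤-unfoldˡ : ∀ n (f : ℕ → ℤ) → Σ≤ (suc n) f ≡ f 0 ℤ.+ Σ≤ n (f ∘ suc)
Σ≤-unfoldˡ zero f = refl
Σ≤-unfoldˡ (suc n) f = begin
  Σ≤ (suc n) f ℤ.+ f (2 + n)                 ≡⟨ cong (ℤ._+ f (2 + n)) (Σ≤-unfoldˡ n f) ⟩
  (f 0 ℤ.+ Σ≤ n (f ∘ suc)) ℤ.+ f (2 + n)    ≡⟨ ℤₚ.+-assoc (f 0) _ _ ⟩
  f 0 ℤ.+ Σ≤ (suc n) (f ∘ suc)               ∎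

Σ≤-single : ∀ n k {f : ℕ → ℤ} → k ≤ n → (∀ i → i ≤ n → i ≢ k → f i ≡ 0ℤ) → Σ≤ n f ≡ f k
Σ≤-single zero zero _ _ = refl
Σ≤-single (suc n) k {f} k≤1+n f≡0 with k ℕₚ.≟ suc n
... | yes refl = begin
  Σ≤ n f ℤ.+ f (suc n) ≡⟨ cong (ℤ._+ f (suc n)) (Σ≤-zero n below) ⟩
  0ℤ ℤ.+ f (suc n)     ≡⟨ ℤₚ.+-identityˡ _ ⟩
  f (suc n)            ∎
  where
  below : ∀ i → i ≤ n → f i ≡ 0ℤ
  below i i≤n = f≡0 i (ℕₚ.m≤n⇒m≤1+n i≤n) (λ i≡1+n → ℕₚ.<-irrefl i≡1+n (s≤s i≤n))
... | no k≢1+n = begin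
  Σ≤ n f ℤ.+ f (suc n) ≡⟨ cong₂ ℤ._+_ (Σ≤-single n k k≤n (λ i i≤n → f≡0 i (ℕₚ.m≤n⇒m≤1+n i≤n)))
                                      (f≡0 (suc n) ℕₚ.≤-refl (k≢1+n ∘ sym)) ⟩
  f k ℤ.+ 0ℤ           ≡⟨ ℤₚ.+-identityʳ _ ⟩
  f k                  ∎
  where
  k≤n : k ≤ n
  k≤n = ℕₚ.≤-pred (ℕₚ.≤∧≢⇒< k≤1+n k≢1+n)

Σ≤-comm : ∀ m n (F : ℕ → ℕ → ℤ) → Σ≤ m (λ i → Σ≤ n (F i)) ≡ Σ≤ n (λ j → Σ≤ m (λ i → F i j))
Σ≤-comm zero n F = refl
Σ≤-comm (suc m) n F = begin
  Σ≤ m (λ i → Σ≤ n (F i)) ℤ.+ Σ≤ n (F (suc m))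
    ≡⟨ cong (ℤ._+ Σ≤ n (F (suc m))) (Σ≤-comm m n F) ⟩
  Σ≤ n (λ j → Σ≤ m (λ i → F i j)) ℤ.+ Σ≤ n (F (suc m))
    ≡⟨ Σ≤-distrib-+ n _ _ ⟨
  Σ≤ n (λ j → Σ≤ (suc m) (λ i → F i j)) ∎

Σ≤-reverse : ∀ n (f : ℕ → ℤ) → Σ≤ n f ≡ Σ≤ n (λ i → f (n ∸ i))
Σ≤-reverse zero f = refl
Σ≤-reverse (suc n) f = begin
  Σ≤ n f ℤ.+ f (suc n)                 ≡⟨ cong (ℤ._+ f (suc n)) (Σ≤-reverse n f) ⟩
  Σ≤ n (λ i → f (n ∸ i)) ℤ.+ f (suc n) ≡⟨ ℤₚ.+-comm _ (f (suc n)) ⟩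
  f (suc n) ℤ.+ Σ≤ n (λ i → f (n ∸ i)) ≡⟨ Σ≤-unfoldˡ n (λ i → f (suc n ∸ i)) ⟨
  Σ≤ (suc n) (λ i → f (suc n ∸ i))     ∎

Σ≤-dropˡ : ∀ k n (f : ℕ → ℤ) → (∀ i → i < k → f i ≡ 0ℤ) → Σ≤ (k + n) f ≡ Σ≤ n (λ j → f (k + j))
Σ≤-dropˡ zero n f f≡0 = refl
Σ≤-dropˡ (suc k) n f f≡0 = begin
  Σ≤ (suc (k + n)) f                ≡⟨ Σ≤-unfoldˡ (k + n) f ⟩
  f 0 ℤ.+ Σ≤ (k + n) (f ∘ suc)      ≡⟨ cong₂ ℤ._+_ (f≡0 0 (s≤s z≤n))
                                         (Σ≤-dropˡ k n (f ∘ suc) (λ i i<k → f≡0 (suc i) (s≤s i<k))) ⟩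
  0ℤ ℤ.+ Σ≤ n (λ j → f (suc k + j)) ≡⟨ ℤₚ.+-identityˡ _ ⟩
  Σ≤ n (λ j → f (suc k + j))        ∎

Σ≤-dropʳ : ∀ k n (f : ℕ → ℤ) → k ≤ n → (∀ i → k < i → i ≤ n → f i ≡ 0ℤ) → Σ≤ n f ≡ Σ≤ k f
Σ≤-dropʳ k zero f z≤n f≡0 = refl
Σ≤-dropʳ k (suc n) f k≤1+n f≡0 with k ℕₚ.≟ suc n
... | yes refl = refl
... | no k≢1+n = begin
  Σ≤ n f ℤ.+ f (suc n) ≡⟨ cong₂ ℤ._+_ (Σ≤-dropʳ k n f k≤n (λ i k<i i≤n → f≡0 i k<i (ℕₚ.m≤n⇒m≤1+n i≤n)))
                                      (f≡0 (suc n) (s≤s k≤n) ℕₚ.≤-refl) ⟩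
  Σ≤ k f ℤ.+ 0ℤ         ≡⟨ ℤₚ.+-identityʳ _ ⟩
  Σ≤ k f               ∎
  where
  k≤n : k ≤ n
  k≤n = ℕₚ.≤-pred (ℕₚ.≤∧≢⇒< k≤1+n k≢1+n)

Σ≤-triangle : ∀ m (F : ℕ → ℕ → ℤ) →
  Σ≤ m (λ i → Σ≤ i (λ k → F k i)) ≡ Σ≤ m (λ k → Σ≤ (m ∸ k) (λ j → F k (k + j)))
Σ≤-triangle zero F = refl
Σ≤-triangle (suc m) F = begin
  Σ≤ m (λ i → Σ≤ i (λ k → F k i)) ℤ.+ (Σ≤ m (λ k → F k (suc m)) ℤ.+ F (suc m) (suc m))
    ≡⟨ cong (ℤ._+ (Σ≤ m (λ k → F k (suc m)) ℤ.+ F (suc m) (suc m))) (Σ≤-triangle m F) ⟩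
  T m ℤ.+ (Σ≤ m (λ k → F k (suc m)) ℤ.+ F (suc m) (suc m))
    ≡⟨ ℤₚ.+-assoc (T m) _ _ ⟨
  (T m ℤ.+ Σ≤ m (λ k → F k (suc m))) ℤ.+ F (suc m) (suc m)
    ≡⟨ cong (ℤ._+ F (suc m) (suc m)) (Σ≤-distrib-+ m _ _) ⟨
  Σ≤ m (λ k → Σ≤ (m ∸ k) (λ j → F k (k + j)) ℤ.+ F k (suc m)) ℤ.+ F (suc m) (suc m)
    ≡⟨ cong₂ ℤ._+_ (Σ≤-cong≤ m extend) last-term ⟩
  T (suc m) ∎
  where
  last-term : F (suc m) (suc m) ≡ Σ≤ (suc m ∸ suc m) (λ j → F (suc m) (suc m + j))
  last-term = trans (cong (F (suc m)) (sym (ℕₚ.+-identityʳ (suc m))))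
                    (cong (λ x → Σ≤ x (λ j → F (suc m) (suc m + j))) (sym (ℕₚ.n∸n≡0 m)))
  T : ℕ → ℤ
  T m = Σ≤ m (λ k → Σ≤ (m ∸ k) (λ j → F k (k + j)))
  extend : ∀ k → k ≤ m → Σ≤ (m ∸ k) (λ j → F k (k + j)) ℤ.+ F k (suc m) ≡ Σ≤ (suc m ∸ k) (λ j → F k (k + j))
  extend k k≤m = begin
    Σ≤ (m ∸ k) (λ j → F k (k + j)) ℤ.+ F k (suc m)
      ≡⟨ cong (λ x → Σ≤ (m ∸ k) (λ j → F k (k + j)) ℤ.+ F k x) k+1+[m∸k]≡1+m ⟨
    Σ≤ (suc (m ∸ k)) (λ j → F k (k + j))
      ≡⟨ cong (λ x → Σ≤ x (λ j → F k (k + j))) (ℕₚ.+-∸-assoc 1 k≤m) ⟨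
    Σ≤ (suc m ∸ k) (λ j → F k (k + j)) ∎
    where
    k+1+[m∸k]≡1+m : k + suc (m ∸ k) ≡ suc m
    k+1+[m∸k]≡1+m = trans (ℕₚ.+-suc k (m ∸ k)) (cong suc (ℕₚ.m+[n∸m]≡n k≤m))

infix 4 _≐_
_≐_ : Series → Series → Set
f ≐ g = ∀ m n → f m n ≡ g m n

≐-refl : ∀ {f} → f ≐ f
≐-refl m n = refl

≐-sym : ∀ {f g} → f ≐ g → g ≐ f
≐-sym f≐g m n = sym (f≐g m n)

≐-trans : ∀ {f g h} → f ≐ g → g ≐ h → f ≐ h
≐-trans f≐g g≐h m n = trans (f≐g m n) (g≐h m n)

infixl 6 _⊞_
_⊞_ : Series → Series → Series
(f ⊞ g) m n = f m n ℤ.+ g m n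

⊟_ : Series → Series
(⊟ f) m n = ℤ.- f m n

𝟘 : Series
𝟘 m n = 0ℤ

mono : ℕ → ℕ → Series
mono a b m n = [ ⌊ (m ℕₚ.≟ a) ×-dec (n ℕₚ.≟ b) ⌋ ]

guard : ∀ {P : Set} → Dec P → ℤ → ℤ
guard (yes _) x = x
guard (no _) x = 0ℤ

-- Written so that κ (+ 1) is definitionally 𝟙, which the ring solver's constant 1 evaluates to.
κ : ℤ → Series
κ c m n = if ⌊ (m ℕₚ.≟ 0) ×-dec (n ℕₚ.≟ 0) ⌋ then c else 0ℤ

shift : ℕ → ℕ → Series → Series
shift a b f m n = guard (a ≤? m) (guard (b ≤? n) (f (m ∸ a) (n ∸ b)))

*-absorbˡ : ∀ {x} y → x ≡ 0ℤ → x ℤ.* y ≡ 0ℤ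
*-absorbˡ y refl = ℤₚ.*-zeroˡ y

*-absorbʳ : ∀ x {y} → y ≡ 0ℤ → x ℤ.* y ≡ 0ℤ
*-absorbʳ x refl = ℤₚ.*-zeroʳ x

guard-yes : ∀ {P : Set} (d : Dec P) x → P → guard d x ≡ x
guard-yes (yes _) x p = refl
guard-yes (no ¬p) x p = ⊥-elim (¬p p)

guard-no : ∀ {P : Set} (d : Dec P) x → ¬ P → guard d x ≡ 0ℤ
guard-no (yes p) x ¬p = ⊥-elim (¬p p)
guard-no (no _) x ¬p = refl

guard-zero : ∀ {P : Set} (d : Dec P) {x} → (P → x ≡ 0ℤ) → guard d x ≡ 0ℤ
guard-zero (yes p) x≡0 = x≡0 p
guard-zero (no _) x≡0 = refl

[]-no : ∀ {P : Set} (d : Dec P) → ¬ P → [ ⌊ d ⌋ ] ≡ 0ℤ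
[]-no (yes p) ¬p = ⊥-elim (¬p p)
[]-no (no _) ¬p = refl

[]-cong : ∀ {P Q : Set} (d : Dec P) (e : Dec Q) → (P → Q) → (Q → P) → [ ⌊ d ⌋ ] ≡ [ ⌊ e ⌋ ]
[]-cong (yes p) (yes q) P→Q Q→P = refl
[]-cong (yes p) (no ¬q) P→Q Q→P = ⊥-elim (¬q (P→Q p))
[]-cong (no ¬p) (yes q) P→Q Q→P = ⊥-elim (¬p (Q→P q))
[]-cong (no ¬p) (no ¬q) P→Q Q→P = refl

mono-on : ∀ a b → mono a b a b ≡ + 1
mono-on a b with a ℕₚ.≟ a | b ℕₚ.≟ b
... | yes _ | yes _ = refl
... | no a≢a | _ = ⊥-elim (a≢a refl)
... | yes _ | no b≢b = ⊥-elim (b≢b refl)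

mono-offˡ : ∀ a b m n → m ≢ a → mono a b m n ≡ 0ℤ
mono-offˡ a b m n m≢a = []-no ((m ℕₚ.≟ a) ×-dec (n ℕₚ.≟ b)) (λ (m≡a , _) → m≢a m≡a)

mono-offʳ : ∀ a b m n → n ≢ b → mono a b m n ≡ 0ℤ
mono-offʳ a b m n n≢b = []-no ((m ℕₚ.≟ a) ×-dec (n ℕₚ.≟ b)) (λ (_ , n≡b) → n≢b n≡b)

⊞-cong : ∀ {f f′ g g′} → f ≐ f′ → g ≐ g′ → f ⊞ g ≐ f′ ⊞ g′
⊞-cong f≐f′ g≐g′ m n = cong₂ ℤ._+_ (f≐f′ m n) (g≐g′ m n)

⊛-cong : ∀ {f f′ g g′} → f ≐ f′ → g ≐ g′ → f ⊛ g ≐ f′ ⊛ g′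
⊛-cong f≐f′ g≐g′ m n =
  Σ≤-cong m (λ i → Σ≤-cong n (λ j → cong₂ ℤ._*_ (f≐f′ i j) (g≐g′ (m ∸ i) (n ∸ j))))

⊛-cong≤ : ∀ {f f′ g g′} m n →
  (∀ i j → i ≤ m → j ≤ n → f i j ≡ f′ i j) → (∀ i j → i ≤ m → j ≤ n → g i j ≡ g′ i j) →
  (f ⊛ g) m n ≡ (f′ ⊛ g′) m n
⊛-cong≤ m n f≡f′ g≡g′ = Σ≤-cong≤ m (λ i i≤m → Σ≤-cong≤ n (λ j j≤n →
  cong₂ ℤ._*_ (f≡f′ i j i≤m j≤n) (g≡g′ (m ∸ i) (n ∸ j) (ℕₚ.m∸n≤m m i) (ℕₚ.m∸n≤m n j))))

⊛-comm : ∀ f g → f ⊛ g ≐ g ⊛ f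
⊛-comm f g m n = begin
  Σ≤ m (λ i → Σ≤ n (λ j → f i j ℤ.* g (m ∸ i) (n ∸ j)))
    ≡⟨ Σ≤-reverse m _ ⟩
  Σ≤ m (λ i → Σ≤ n (λ j → f (m ∸ i) j ℤ.* g (m ∸ (m ∸ i)) (n ∸ j)))
    ≡⟨ Σ≤-cong m (λ i → Σ≤-reverse n _) ⟩
  Σ≤ m (λ i → Σ≤ n (λ j → f (m ∸ i) (n ∸ j) ℤ.* g (m ∸ (m ∸ i)) (n ∸ (n ∸ j))))
    ≡⟨ Σ≤-cong≤ m (λ i i≤m → Σ≤-cong≤ n (λ j j≤n → swap i j i≤m j≤n)) ⟩
  Σ≤ m (λ i → Σ≤ n (λ j → g i j ℤ.* f (m ∸ i) (n ∸ j))) ∎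
  where
  swap : ∀ i j → i ≤ m → j ≤ n →
    f (m ∸ i) (n ∸ j) ℤ.* g (m ∸ (m ∸ i)) (n ∸ (n ∸ j)) ≡ g i j ℤ.* f (m ∸ i) (n ∸ j)
  swap i j i≤m j≤n = trans (ℤₚ.*-comm (f (m ∸ i) (n ∸ j)) _)
    (cong₂ (λ x y → g x y ℤ.* f (m ∸ i) (n ∸ j)) (ℕₚ.m∸[m∸n]≡n i≤m) (ℕₚ.m∸[m∸n]≡n j≤n))

convolution₃ : Series → Series → Series → Series
convolution₃ f g h m n =
  Σ≤ m (λ i → Σ≤ (m ∸ i) (λ k → Σ≤ n (λ j → Σ≤ (n ∸ j) (λ l →
    f i j ℤ.* (g k l ℤ.* h (m ∸ i ∸ k) (n ∸ j ∸ l))))))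

⊛-assocˡ : ∀ f g h → (f ⊛ g) ⊛ h ≐ convolution₃ f g h
⊛-assocˡ f g h m n = begin
  Σ≤ m (λ i → Σ≤ n (λ j → Σ≤ i (λ i′ → Σ≤ j (λ j′ → f i′ j′ ℤ.* g (i ∸ i′) (j ∸ j′))) ℤ.* h (m ∸ i) (n ∸ j)))
    ≡⟨ Σ≤-cong m (λ i → Σ≤-cong n (λ j → trans (sym (Σ≤-*ʳ i _ _))
                                                (Σ≤-cong i (λ i′ → sym (Σ≤-*ʳ j _ _))))) ⟩
  Σ≤ m (λ i → Σ≤ n (λ j → Σ≤ i (λ i′ → Σ≤ j (λ j′ → (f i′ j′ ℤ.* g (i ∸ i′) (j ∸ j′)) ℤ.* h (m ∸ i) (n ∸ j)))))
    ≡⟨ Σ≤-cong m (λ i → Σ≤-comm n i _) ⟩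
  Σ≤ m (λ i → Σ≤ i (λ i′ → Σ≤ n (λ j → Σ≤ j (λ j′ → (f i′ j′ ℤ.* g (i ∸ i′) (j ∸ j′)) ℤ.* h (m ∸ i) (n ∸ j)))))
    ≡⟨ Σ≤-triangle m _ ⟩
  Σ≤ m (λ i → Σ≤ (m ∸ i) (λ k → Σ≤ n (λ j → Σ≤ j (λ j′ → (f i j′ ℤ.* g (i + k ∸ i) (j ∸ j′)) ℤ.* h (m ∸ (i + k)) (n ∸ j)))))
    ≡⟨ Σ≤-cong m (λ i → Σ≤-cong (m ∸ i) (λ k → Σ≤-triangle n _)) ⟩
  Σ≤ m (λ i → Σ≤ (m ∸ i) (λ k → Σ≤ n (λ j → Σ≤ (n ∸ j) (λ l → (f i j ℤ.* g (i + k ∸ i) (j + l ∸ j)) ℤ.* h (m ∸ (i + k)) (n ∸ (j + l))))))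
    ≡⟨ Σ≤-cong m (λ i → Σ≤-cong (m ∸ i) (λ k → Σ≤-cong n (λ j → Σ≤-cong (n ∸ j) (reindex i k j)))) ⟩
  convolution₃ f g h m n ∎
  where
  reindex : ∀ i k j l → (f i j ℤ.* g (i + k ∸ i) (j + l ∸ j)) ℤ.* h (m ∸ (i + k)) (n ∸ (j + l))
                        ≡ f i j ℤ.* (g k l ℤ.* h (m ∸ i ∸ k) (n ∸ j ∸ l))
  reindex i k j l = begin
    (f i j ℤ.* g (i + k ∸ i) (j + l ∸ j)) ℤ.* h (m ∸ (i + k)) (n ∸ (j + l))
      ≡⟨ ℤₚ.*-assoc (f i j) _ _ ⟩
    f i j ℤ.* (g (i + k ∸ i) (j + l ∸ j) ℤ.* h (m ∸ (i + k)) (n ∸ (j + l)))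
      ≡⟨ cong₂ (λ x y → f i j ℤ.* (g x y ℤ.* h (m ∸ (i + k)) (n ∸ (j + l))))
               (ℕₚ.m+n∸m≡n i k) (ℕₚ.m+n∸m≡n j l) ⟩
    f i j ℤ.* (g k l ℤ.* h (m ∸ (i + k)) (n ∸ (j + l)))
      ≡⟨ cong₂ (λ x y → f i j ℤ.* (g k l ℤ.* h x y)) (ℕₚ.∸-+-assoc m i k) (ℕₚ.∸-+-assoc n j l) ⟨
    f i j ℤ.* (g k l ℤ.* h (m ∸ i ∸ k) (n ∸ j ∸ l)) ∎

⊛-assocʳ : ∀ f g h → f ⊛ (g ⊛ h) ≐ convolution₃ f g h
⊛-assocʳ f g h m n = begin
  Σ≤ m (λ i → Σ≤ n (λ j → f i j ℤ.* Σ≤ (m ∸ i) (λ k → Σ≤ (n ∸ j) (gh i j k))))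
    ≡⟨ Σ≤-cong m (λ i → Σ≤-cong n (λ j → trans (sym (Σ≤-*ˡ (m ∸ i) (f i j) (λ k → Σ≤ (n ∸ j) (gh i j k))))
                                                (Σ≤-cong (m ∸ i) (λ k → sym (Σ≤-*ˡ (n ∸ j) (f i j) (gh i j k)))))) ⟩
  Σ≤ m (λ i → Σ≤ n (λ j → Σ≤ (m ∸ i) (λ k → Σ≤ (n ∸ j) (λ l → f i j ℤ.* gh i j k l))))
    ≡⟨ Σ≤-cong m (λ i → Σ≤-comm n (m ∸ i) _) ⟩
  convolution₃ f g h m n ∎
  where
  gh : ℕ → ℕ → ℕ → ℕ → ℤ
  gh i j k l = g k l ℤ.* h (m ∸ i ∸ k) (n ∸ j ∸ l)

⊛-assoc : ∀ f g h → (f ⊛ g) ⊛ h ≐ f ⊛ (g ⊛ h)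
⊛-assoc f g h = ≐-trans (⊛-assocˡ f g h) (≐-sym (⊛-assocʳ f g h))

⊛-distribʳ : ∀ f g h → (f ⊞ g) ⊛ h ≐ f ⊛ h ⊞ g ⊛ h
⊛-distribʳ f g h m n = begin
  Σ≤ m (λ i → Σ≤ n (λ j → (f i j ℤ.+ g i j) ℤ.* h (m ∸ i) (n ∸ j)))
    ≡⟨ Σ≤-cong m (λ i → trans (Σ≤-cong n (λ j → ℤₚ.*-distribʳ-+ (h (m ∸ i) (n ∸ j)) (f i j) (g i j)))
                              (Σ≤-distrib-+ n _ _)) ⟩
  Σ≤ m (λ i → Σ≤ n (λ j → f i j ℤ.* h (m ∸ i) (n ∸ j)) ℤ.+ Σ≤ n (λ j → g i j ℤ.* h (m ∸ i) (n ∸ j)))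
    ≡⟨ Σ≤-distrib-+ m _ _ ⟩
  (f ⊛ h) m n ℤ.+ (g ⊛ h) m n ∎

⊛-distribˡ : ∀ f g h → f ⊛ (g ⊞ h) ≐ f ⊛ g ⊞ f ⊛ h
⊛-distribˡ f g h m n = begin
  (f ⊛ (g ⊞ h)) m n           ≡⟨ ⊛-comm f (g ⊞ h) m n ⟩
  ((g ⊞ h) ⊛ f) m n           ≡⟨ ⊛-distribʳ g h f m n ⟩
  (g ⊛ f) m n ℤ.+ (h ⊛ f) m n ≡⟨ cong₂ ℤ._+_ (⊛-comm g f m n) (⊛-comm h f m n) ⟩
  (f ⊛ g) m n ℤ.+ (f ⊛ h) m n ∎

⊛-negˡ : ∀ f g → (⊟ f) ⊛ g ≐ ⊟ (f ⊛ g)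
⊛-negˡ f g m n = begin
  Σ≤ m (λ i → Σ≤ n (λ j → ℤ.- f i j ℤ.* g (m ∸ i) (n ∸ j)))
    ≡⟨ Σ≤-cong m (λ i → trans (Σ≤-cong n (λ j → sym (ℤₚ.neg-distribˡ-* (f i j) (g (m ∸ i) (n ∸ j)))))
                              (Σ≤-neg n _)) ⟩
  Σ≤ m (λ i → ℤ.- Σ≤ n (λ j → f i j ℤ.* g (m ∸ i) (n ∸ j)))
    ≡⟨ Σ≤-neg m _ ⟩
  ℤ.- (f ⊛ g) m n ∎

⊛-negʳ : ∀ f g → f ⊛ ⊟ g ≐ ⊟ (f ⊛ g)
⊛-negʳ f g m n = trans (⊛-comm f (⊟ g) m n) (trans (⊛-negˡ g f m n) (cong ℤ.-_ (⊛-comm g f m n)))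

mono-⊛ : ∀ a b f → mono a b ⊛ f ≐ shift a b f
mono-⊛ a b f m n with a ≤? m | b ≤? n
... | yes a≤m | yes b≤n = begin
  Σ≤ m (λ i → Σ≤ n (λ j → mono a b i j ℤ.* f (m ∸ i) (n ∸ j)))
    ≡⟨ Σ≤-single m a a≤m (λ i _ i≢a → Σ≤-zero n (λ j _ → *-absorbˡ _ (mono-offˡ a b i j i≢a))) ⟩
  Σ≤ n (λ j → mono a b a j ℤ.* f (m ∸ a) (n ∸ j))
    ≡⟨ Σ≤-single n b b≤n (λ j _ j≢b → *-absorbˡ _ (mono-offʳ a b a j j≢b)) ⟩
  mono a b a b ℤ.* f (m ∸ a) (n ∸ b)
    ≡⟨ cong (ℤ._* f (m ∸ a) (n ∸ b)) (mono-on a b) ⟩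
  + 1 ℤ.* f (m ∸ a) (n ∸ b)
    ≡⟨ ℤₚ.*-identityˡ _ ⟩
  f (m ∸ a) (n ∸ b) ∎
... | no a≰m | _ = Σ≤-zero m (λ i i≤m → Σ≤-zero n (λ j _ →
  *-absorbˡ _ (mono-offˡ a b i j (λ i≡a → a≰m (subst (_≤ m) i≡a i≤m)))))
... | yes _ | no b≰n = Σ≤-zero m (λ i _ → Σ≤-zero n (λ j j≤n →
  *-absorbˡ _ (mono-offʳ a b i j (λ j≡b → b≰n (subst (_≤ n) j≡b j≤n)))))

⊛-identityˡ : ∀ f → 𝟙 ⊛ f ≐ f
⊛-identityˡ = mono-⊛ 0 0

⊛-identityʳ : ∀ f → f ⊛ 𝟙 ≐ f
⊛-identityʳ f = ≐-trans (⊛-comm f 𝟙) (⊛-identityˡ f)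

κ≡*𝟙 : ∀ c m n → κ c m n ≡ c ℤ.* 𝟙 m n
κ≡*𝟙 c m n with (m ℕₚ.≟ 0) ×-dec (n ℕₚ.≟ 0)
... | yes _ = sym (ℤₚ.*-identityʳ c)
... | no _ = sym (ℤₚ.*-zeroʳ c)

κ-⊛ : ∀ c f → κ c ⊛ f ≐ (λ m n → c ℤ.* f m n)
κ-⊛ c f m n = begin
  Σ≤ m (λ i → Σ≤ n (λ j → κ c i j ℤ.* f (m ∸ i) (n ∸ j)))
    ≡⟨ Σ≤-cong m (λ i → trans (Σ≤-cong n (λ j → trans (cong (ℤ._* f (m ∸ i) (n ∸ j)) (κ≡*𝟙 c i j))
                                                       (ℤₚ.*-assoc c (𝟙 i j) (f (m ∸ i) (n ∸ j)))))
                              (Σ≤-*ˡ n c _)) ⟩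
  Σ≤ m (λ i → c ℤ.* Σ≤ n (λ j → 𝟙 i j ℤ.* f (m ∸ i) (n ∸ j)))
    ≡⟨ Σ≤-*ˡ m c _ ⟩
  c ℤ.* (𝟙 ⊛ f) m n
    ≡⟨ cong (c ℤ.*_) (⊛-identityˡ f m n) ⟩
  c ℤ.* f m n ∎

⊛-isCommutativeRing : IsCommutativeRing _≐_ _⊞_ _⊛_ ⊟_ 𝟘 𝟙
⊛-isCommutativeRing = record
  { isRing = record
    { +-isAbelianGroup = record
      { isGroup = record
        { isMonoid = record
          { isSemigroup = record
            { isMagma = record
              { isEquivalence = record { refl = ≐-refl ; sym = ≐-sym ; trans = ≐-trans }
              ; ∙-cong = ⊞-cong }
            ; assoc = λ f g h m n → ℤₚ.+-assoc (f m n) (g m n) (h m n) }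
          ; identity = (λ f m n → ℤₚ.+-identityˡ (f m n)) , (λ f m n → ℤₚ.+-identityʳ (f m n)) }
        ; inverse = (λ f m n → ℤₚ.+-inverseˡ (f m n)) , (λ f m n → ℤₚ.+-inverseʳ (f m n))
        ; ⁻¹-cong = λ f≐f′ m n → cong ℤ.-_ (f≐f′ m n) }
      ; comm = λ f g m n → ℤₚ.+-comm (f m n) (g m n) }
    ; *-cong = ⊛-cong
    ; *-assoc = ⊛-assoc
    ; *-identity = ⊛-identityˡ , ⊛-identityʳ
    ; distrib = ⊛-distribˡ , λ h f g → ⊛-distribʳ f g h }
  ; *-comm = ⊛-comm }

⊛-commutativeRing : CommutativeRing _ _
⊛-commutativeRing = record { isCommutativeRing = ⊛-isCommutativeRing }

κ-homomorphism : CommutativeRing.rawRing ℤₚ.+-*-commutativeRing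
  -Raw-AlmostCommutative⟶ fromCommutativeRing ⊛-commutativeRing
κ-homomorphism = record
  { ⟦_⟧ = κ
  ; +-homo = λ a b m n → if-+ ⌊ (m ℕₚ.≟ 0) ×-dec (n ℕₚ.≟ 0) ⌋ a b
  ; *-homo = λ a b m n → trans (κ-* a b m n) (sym (κ-⊛ a (κ b) m n))
  ; -‿homo = λ a m n → if-neg ⌊ (m ℕₚ.≟ 0) ×-dec (n ℕₚ.≟ 0) ⌋ a
  ; 0-homo = λ m n → if-0 ⌊ (m ℕₚ.≟ 0) ×-dec (n ℕₚ.≟ 0) ⌋
  ; 1-homo = ≐-refl
  }
  where
  if-+ : ∀ b x y → (if b then x ℤ.+ y else 0ℤ) ≡ (if b then x else 0ℤ) ℤ.+ (if b then y else 0ℤ)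
  if-+ true x y = refl
  if-+ false x y = refl
  if-neg : ∀ b x → (if b then ℤ.- x else 0ℤ) ≡ ℤ.- (if b then x else 0ℤ)
  if-neg true x = refl
  if-neg false x = refl
  if-0 : ∀ b → (if b then 0ℤ else 0ℤ) ≡ 0ℤ
  if-0 true = refl
  if-0 false = refl
  κ-* : ∀ a b m n → κ (a ℤ.* b) m n ≡ a ℤ.* κ b m n
  κ-* a b m n = trans (κ≡*𝟙 (a ℤ.* b) m n) (trans (ℤₚ.*-assoc a b (𝟙 m n)) (cong (a ℤ.*_) (sym (κ≡*𝟙 b m n))))

κ-≟ : ∀ a b → Maybe (κ a ≐ κ b)
κ-≟ a b with a ℤₚ.≟ b
... | yes refl = just ≐-refl
... | no _ = nothing

module ⊛-Solver = RingSolver _ _ κ-homomorphism κ-≟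

-- The substitution z ↦ z q

σ : Series → Series
σ f m n = guard (m ≤? n) (f m (n ∸ m))

σ-⊞ : ∀ f g → σ (f ⊞ g) ≐ σ f ⊞ σ g
σ-⊞ f g m n with m ≤? n
... | yes _ = refl
... | no _ = refl

σ-⊟ : ∀ f → σ (⊟ f) ≐ ⊟ σ f
σ-⊟ f m n with m ≤? n
... | yes _ = refl
... | no _ = refl

σ-cong : ∀ {f g} → f ≐ g → σ f ≐ σ g
σ-cong f≐g m n = cong (guard (m ≤? n)) (f≐g m (n ∸ m))

σ-mono : ∀ a b → σ (mono a b) ≐ mono a (a + b)
σ-mono a b m n with m ≤? n
... | yes m≤n = []-cong ((m ℕₚ.≟ a) ×-dec (n ∸ m ℕₚ.≟ b)) ((m ℕₚ.≟ a) ×-dec (n ℕₚ.≟ a + b))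
  (λ (m≡a , n∸m≡b) → m≡a , trans (sym (ℕₚ.m+[n∸m]≡n m≤n)) (cong₂ _+_ m≡a n∸m≡b))
  (λ (m≡a , n≡a+b) → m≡a , trans (cong₂ _∸_ n≡a+b m≡a) (ℕₚ.m+n∸m≡n a b))
... | no m≰n = sym ([]-no ((m ℕₚ.≟ a) ×-dec (n ℕₚ.≟ a + b))
  (λ (m≡a , n≡a+b) → m≰n (subst₂ _≤_ (sym m≡a) (sym n≡a+b) (ℕₚ.m≤m+n a b))))

σ-𝟙 : σ 𝟙 ≐ 𝟙
σ-𝟙 = σ-mono 0 0

Σ≤-guarded-convolution : ∀ (F G : ℕ → ℤ) i a d N → i + (d + a) ≡ N →
  Σ≤ N (λ j → guard (i ≤? j) (F (j ∸ i)) ℤ.* guard (a ≤? N ∸ j) (G (N ∸ j ∸ a)))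
    ≡ Σ≤ d (λ j → F j ℤ.* G (d ∸ j))
Σ≤-guarded-convolution F G i a d .(i + (d + a)) refl = begin
  Σ≤ N H                          ≡⟨ Σ≤-dropˡ i (d + a) H before ⟩
  Σ≤ (d + a) (λ j → H (i + j))    ≡⟨ Σ≤-dropʳ d (d + a) (λ j → H (i + j)) (ℕₚ.m≤m+n d a) after ⟩
  Σ≤ d (λ j → H (i + j))          ≡⟨ Σ≤-cong≤ d inside ⟩
  Σ≤ d (λ j → F j ℤ.* G (d ∸ j))  ∎
  where
  N : ℕ
  N = i + (d + a)
  H : ℕ → ℤ
  H j = guard (i ≤? j) (F (j ∸ i)) ℤ.* guard (a ≤? N ∸ j) (G (N ∸ j ∸ a))
  N∸[i+j]≡d+a∸j : ∀ j → N ∸ (i + j) ≡ d + a ∸ j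
  N∸[i+j]≡d+a∸j j = ℕₚ.[m+n]∸[m+o]≡n∸o i (d + a) j
  before : ∀ j → j < i → H j ≡ 0ℤ
  before j j<i = *-absorbˡ (guard (a ≤? N ∸ j) (G (N ∸ j ∸ a))) (guard-no (i ≤? j) (F (j ∸ i)) (ℕₚ.<⇒≱ j<i))
  after : ∀ j → d < j → j ≤ d + a → H (i + j) ≡ 0ℤ
  after j d<j j≤d+a =
    *-absorbʳ (guard (i ≤? i + j) (F (i + j ∸ i))) (guard-no (a ≤? N ∸ (i + j)) (G (N ∸ (i + j) ∸ a)) a≰)
    where
    a≰ : ¬ (a ≤ N ∸ (i + j))
    a≰ a≤ = ℕₚ.<⇒≱ d<j (ℕₚ.+-cancelˡ-≤ a j d (subst (a + j ≤_) a+d≡ (ℕₚ.+-monoˡ-≤ j a≤′)))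
      where
      a≤′ : a ≤ d + a ∸ j
      a≤′ = subst (a ≤_) (N∸[i+j]≡d+a∸j j) a≤
      a+d≡ : d + a ∸ j + j ≡ a + d
      a+d≡ = trans (ℕₚ.m∸n+n≡m j≤d+a) (ℕₚ.+-comm d a)
  inside : ∀ j → j ≤ d → H (i + j) ≡ F j ℤ.* G (d ∸ j)
  inside j j≤d = cong₂ ℤ._*_
    (trans (guard-yes (i ≤? i + j) (F (i + j ∸ i)) (ℕₚ.m≤m+n i j)) (cong F (ℕₚ.m+n∸m≡n i j)))
    (trans (guard-yes (a ≤? N ∸ (i + j)) (G (N ∸ (i + j) ∸ a)) (subst (a ≤_) (sym N∸[i+j]≡) (ℕₚ.m≤n+m a (d ∸ j))))
           (cong G (trans (cong (_∸ a) N∸[i+j]≡) (ℕₚ.m+n∸n≡m (d ∸ j) a))))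
    where
    N∸[i+j]≡ : N ∸ (i + j) ≡ d ∸ j + a
    N∸[i+j]≡ = trans (N∸[i+j]≡d+a∸j j) (ℕₚ.+-∸-comm a j≤d)

σ-⊛ : ∀ f g → σ (f ⊛ g) ≐ σ f ⊛ σ g
σ-⊛ f g m n with m ≤? n
... | yes m≤n = sym (Σ≤-cong≤ m (λ i i≤m →
  Σ≤-guarded-convolution (f i) (g (m ∸ i)) i (m ∸ i) (n ∸ m) n (split i i≤m)))
  where
  split : ∀ i → i ≤ m → i + ((n ∸ m) + (m ∸ i)) ≡ n
  split i i≤m = begin
    i + ((n ∸ m) + (m ∸ i)) ≡⟨ cong (_+_ i) (ℕₚ.+-∸-assoc (n ∸ m) i≤m) ⟨
    i + ((n ∸ m) + m ∸ i)   ≡⟨ cong (λ k → i + (k ∸ i)) (ℕₚ.m∸n+n≡m m≤n) ⟩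
    i + (n ∸ i)             ≡⟨ ℕₚ.m+[n∸m]≡n (ℕₚ.≤-trans i≤m m≤n) ⟩
    n                       ∎
... | no m≰n = sym (Σ≤-zero m (λ i i≤m → Σ≤-zero n (λ j j≤n →
  vanish (i ≤? j) (m ∸ i ≤? n ∸ j) (λ i≤j m∸i≤n∸j → m≰n (subst₂ _≤_ (ℕₚ.m∸n+n≡m i≤m) (ℕₚ.m∸n+n≡m j≤n)
                                                         (ℕₚ.+-mono-≤ m∸i≤n∸j i≤j))))))
  where
  vanish : ∀ {P Q : Set} (p : Dec P) (q : Dec Q) {x y} → (P → Q → ⊥) → guard p x ℤ.* guard q y ≡ 0ℤ
  vanish (no _) q {y = y} _ = ℤₚ.*-zeroˡ (guard q y)
  vanish (yes _) (no _) {x} _ = ℤₚ.*-zeroʳ x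
  vanish (yes p) (yes q) ¬pq = ⊥-elim (¬pq p q)

∏<-unfoldˡ : ∀ N f → ∏< (suc N) f ≐ f 0 ⊛ ∏< N (f ∘ suc)
∏<-unfoldˡ zero f = ⊛-comm 𝟙 (f 0)
∏<-unfoldˡ (suc N) f =
  ≐-trans (⊛-cong (∏<-unfoldˡ N f) (≐-refl {f (suc N)})) (⊛-assoc (f 0) (∏< N (f ∘ suc)) (f (suc N)))

∏<-cong : ∀ N {f g} → (∀ i → f i ≐ g i) → ∏< N f ≐ ∏< N g
∏<-cong zero f≐g = ≐-refl
∏<-cong (suc N) f≐g = ⊛-cong (∏<-cong N f≐g) (f≐g N)

σ-∏< : ∀ N f → σ (∏< N f) ≐ ∏< N (σ ∘ f)
σ-∏< zero f = σ-𝟙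
σ-∏< (suc N) f = ≐-trans (σ-⊛ (∏< N f) (f N)) (⊛-cong (σ-∏< N f) (≐-refl {σ (f N)}))

σ-oneMinus : ∀ a b → σ (oneMinus a b) ≐ oneMinus a (a + b)
σ-oneMinus a b m n = trans (σ-⊞ 𝟙 (⊟ mono a b) m n)
  (cong₂ ℤ._+_ (σ-𝟙 m n) (trans (σ-⊟ (mono a b) m n) (cong ℤ.-_ (σ-mono a b m n))))

a≤a*[1+k] : ∀ a k → a ≤ a ℕ.* suc k
a≤a*[1+k] a k = subst (a ≤_) (sym (ℕₚ.*-suc a k)) (ℕₚ.m≤m+n a (a ℕ.* k))

geom-off : ∀ a b m n → (∀ k → ¬ (m ≡ a ℕ.* suc k × n ≡ b ℕ.* suc k)) → geom a b m n ≡ 𝟙 m n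
geom-off a b m n off = begin
  geom a b m n
    ≡⟨ Σ≤-single n 0 z≤n (λ k _ k≢0 → []-no ((m ℕₚ.≟ a ℕ.* k) ×-dec (n ℕₚ.≟ b ℕ.* k)) (off′ k k≢0)) ⟩
  [ ⌊ (m ℕₚ.≟ a ℕ.* 0) ×-dec (n ℕₚ.≟ b ℕ.* 0) ⌋ ]
    ≡⟨ []-cong ((m ℕₚ.≟ a ℕ.* 0) ×-dec (n ℕₚ.≟ b ℕ.* 0)) ((m ℕₚ.≟ 0) ×-dec (n ℕₚ.≟ 0))
         (λ (p , q) → trans p (ℕₚ.*-zeroʳ a) , trans q (ℕₚ.*-zeroʳ b))
         (λ (p , q) → trans p (sym (ℕₚ.*-zeroʳ a)) , trans q (sym (ℕₚ.*-zeroʳ b))) ⟩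
  𝟙 m n ∎
  where
  off′ : ∀ k → k ≢ 0 → ¬ (m ≡ a ℕ.* k × n ≡ b ℕ.* k)
  off′ zero k≢0 _ = k≢0 refl
  off′ (suc k) _ = off k

geom-periodic : ∀ a b m n → 1 ≤ b → a ≤ m → b ≤ n → geom a b m n ≡ geom a b (m ∸ a) (n ∸ b)
geom-periodic a b m zero 1≤b _ b≤0 = ⊥-elim (ℕₚ.<⇒≱ 1≤b b≤0)
geom-periodic a b m (suc n) 1≤b a≤m b≤1+n = begin
  geom a b m (suc n)             ≡⟨ Σ≤-unfoldˡ n F ⟩
  F 0 ℤ.+ Σ≤ n (F ∘ suc)         ≡⟨ cong (ℤ._+ Σ≤ n (F ∘ suc)) F0≡0 ⟩
  0ℤ ℤ.+ Σ≤ n (F ∘ suc)          ≡⟨ ℤₚ.+-identityˡ _ ⟩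
  Σ≤ n (F ∘ suc)                 ≡⟨ Σ≤-cong n F[1+k]≡G ⟩
  Σ≤ n G                         ≡⟨ Σ≤-dropʳ (suc n ∸ b) n G (ℕₚ.∸-monoʳ-≤ (suc n) 1≤b) G-off ⟩
  Σ≤ (suc n ∸ b) G               ∎
  where
  F G : ℕ → ℤ
  F k = [ ⌊ (m ℕₚ.≟ a ℕ.* k) ×-dec (suc n ℕₚ.≟ b ℕ.* k) ⌋ ]
  G k = [ ⌊ (m ∸ a ℕₚ.≟ a ℕ.* k) ×-dec (suc n ∸ b ℕₚ.≟ b ℕ.* k) ⌋ ]
  F0≡0 : F 0 ≡ 0ℤ
  F0≡0 = []-no ((m ℕₚ.≟ a ℕ.* 0) ×-dec (suc n ℕₚ.≟ b ℕ.* 0))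
               (λ (_ , q) → ℕₚ.1+n≢0 (trans q (ℕₚ.*-zeroʳ b)))
  peel : ∀ c x k → c ≤ x → (x ≡ c ℕ.* suc k → x ∸ c ≡ c ℕ.* k) × (x ∸ c ≡ c ℕ.* k → x ≡ c ℕ.* suc k)
  peel c x k c≤x =
    (λ e → trans (cong (_∸ c) (trans e (ℕₚ.*-suc c k))) (ℕₚ.m+n∸m≡n c (c ℕ.* k))) ,
    (λ e → trans (sym (ℕₚ.m+[n∸m]≡n c≤x)) (trans (cong (_+_ c) e) (sym (ℕₚ.*-suc c k))))
  F[1+k]≡G : ∀ k → F (suc k) ≡ G k
  F[1+k]≡G k = []-cong ((m ℕₚ.≟ a ℕ.* suc k) ×-dec (suc n ℕₚ.≟ b ℕ.* suc k))
                       ((m ∸ a ℕₚ.≟ a ℕ.* k) ×-dec (suc n ∸ b ℕₚ.≟ b ℕ.* k))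
    (λ (p , q) → proj₁ (peel a m k a≤m) p , proj₁ (peel b (suc n) k b≤1+n) q)
    (λ (p , q) → proj₂ (peel a m k a≤m) p , proj₂ (peel b (suc n) k b≤1+n) q)
  G-off : ∀ k → suc n ∸ b < k → k ≤ n → G k ≡ 0ℤ
  G-off k lt _ = []-no ((m ∸ a ℕₚ.≟ a ℕ.* k) ×-dec (suc n ∸ b ℕₚ.≟ b ℕ.* k))
    (λ (_ , q) → ℕₚ.<⇒≢ (ℕₚ.<-≤-trans lt (ℕₚ.m≤n*m k b ⦃ ℕ.≢-nonZero (λ b≡0 → ℕₚ.<⇒≢ 1≤b (sym b≡0)) ⦄)) q)

geom-inverse : ∀ a b → 1 ≤ b → oneMinus a b ⊛ geom a b ≐ 𝟙
geom-inverse a b 1≤b m n = begin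
  ((𝟙 ⊞ ⊟ mono a b) ⊛ geom a b) m n
    ≡⟨ ⊛-distribʳ 𝟙 (⊟ mono a b) (geom a b) m n ⟩
  (𝟙 ⊛ geom a b) m n ℤ.+ ((⊟ mono a b) ⊛ geom a b) m n
    ≡⟨ cong₂ ℤ._+_ (⊛-identityˡ (geom a b) m n)
                   (trans (⊛-negˡ (mono a b) (geom a b) m n) (cong ℤ.-_ (mono-⊛ a b (geom a b) m n))) ⟩
  geom a b m n ℤ.- shift a b (geom a b) m n
    ≡⟨ telescope (a ≤? m) (b ≤? n) ⟩
  𝟙 m n ∎
  where
  telescope : (a≤?m : Dec (a ≤ m)) (b≤?n : Dec (b ≤ n)) →
    geom a b m n ℤ.- guard a≤?m (guard b≤?n (geom a b (m ∸ a) (n ∸ b))) ≡ 𝟙 m n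
  telescope (yes a≤m) (yes b≤n) = begin
    geom a b m n ℤ.- geom a b (m ∸ a) (n ∸ b)
      ≡⟨ cong (ℤ._- geom a b (m ∸ a) (n ∸ b)) (geom-periodic a b m n 1≤b a≤m b≤n) ⟩
    geom a b (m ∸ a) (n ∸ b) ℤ.- geom a b (m ∸ a) (n ∸ b)
      ≡⟨ ℤₚ.+-inverseʳ (geom a b (m ∸ a) (n ∸ b)) ⟩
    0ℤ
      ≡⟨ mono-offʳ 0 0 m n (λ n≡0 → ℕₚ.<⇒≱ 1≤b (subst (b ≤_) n≡0 b≤n)) ⟨
    𝟙 m n ∎
  telescope (yes _) (no b≰n) = trans (ℤₚ.+-identityʳ (geom a b m n))
    (geom-off a b m n (λ k (_ , n≡) → b≰n (subst (b ≤_) (sym n≡) (a≤a*[1+k] b k))))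
  telescope (no a≰m) _ = trans (ℤₚ.+-identityʳ (geom a b m n))
    (geom-off a b m n (λ k (m≡ , _) → a≰m (subst (a ≤_) (sym m≡) (a≤a*[1+k] a k))))

inverse-unique : ∀ u x y → u ⊛ x ≐ 𝟙 → u ⊛ y ≐ 𝟙 → x ≐ y
inverse-unique u x y ux≐1 uy≐1 m n = begin
  x m n             ≡⟨ ⊛-identityʳ x m n ⟨
  (x ⊛ 𝟙) m n       ≡⟨ ⊛-cong (≐-refl {x}) uy≐1 m n ⟨
  (x ⊛ (u ⊛ y)) m n ≡⟨ ⊛-assoc x u y m n ⟨
  ((x ⊛ u) ⊛ y) m n ≡⟨ ⊛-cong (⊛-comm x u) (≐-refl {y}) m n ⟩
  ((u ⊛ x) ⊛ y) m n ≡⟨ ⊛-cong ux≐1 (≐-refl {y}) m n ⟩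
  (𝟙 ⊛ y) m n       ≡⟨ ⊛-identityˡ y m n ⟩
  y m n             ∎

σ-geom : ∀ a b → 1 ≤ b → σ (geom a b) ≐ geom a (a + b)
σ-geom a b 1≤b = inverse-unique (oneMinus a (a + b)) (σ (geom a b)) (geom a (a + b))
  σ-inverse (geom-inverse a (a + b) (ℕₚ.≤-trans 1≤b (ℕₚ.m≤n+m b a)))
  where
  σ-inverse : oneMinus a (a + b) ⊛ σ (geom a b) ≐ 𝟙
  σ-inverse m n = begin
    (oneMinus a (a + b) ⊛ σ (geom a b)) m n ≡⟨ ⊛-cong (σ-oneMinus a b) (≐-refl {σ (geom a b)}) m n ⟨
    (σ (oneMinus a b) ⊛ σ (geom a b)) m n   ≡⟨ σ-⊛ (oneMinus a b) (geom a b) m n ⟨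
    σ (oneMinus a b ⊛ geom a b) m n         ≡⟨ σ-cong (geom-inverse a b 1≤b) m n ⟩
    σ 𝟙 m n                                 ≡⟨ σ-𝟙 m n ⟩
    𝟙 m n                                   ∎

TrivialUpTo : ℕ → Series → Set
TrivialUpTo N w = ∀ i j → j ≤ N → w i j ≡ 𝟙 i j

⊛-trivialUpTo : ∀ N f w → TrivialUpTo N w → ∀ m n → n ≤ N → (f ⊛ w) m n ≡ f m n
⊛-trivialUpTo N f w w≡1 m n n≤N =
  trans (⊛-cong≤ {f} {f} {w} {𝟙} m n (λ _ _ _ _ → refl) (λ i j _ j≤n → w≡1 i j (ℕₚ.≤-trans j≤n n≤N))) (⊛-identityʳ f m n)

trivialUpTo-⊛ : ∀ N v w → TrivialUpTo N v → TrivialUpTo N w → TrivialUpTo N (v ⊛ w)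
trivialUpTo-⊛ N v w v≡1 w≡1 i j j≤N = trans (⊛-trivialUpTo N v w w≡1 i j j≤N) (v≡1 i j j≤N)

trivialUpTo-oneMinus : ∀ N a b → N < b → TrivialUpTo N (oneMinus a b)
trivialUpTo-oneMinus N a b N<b i j j≤N =
  trans (cong (λ x → 𝟙 i j ℤ.- x) (mono-offʳ a b i j (λ j≡b → ℕₚ.<⇒≱ N<b (subst (_≤ N) j≡b j≤N))))
        (ℤₚ.+-identityʳ (𝟙 i j))

trivialUpTo-geom : ∀ N a b → N < b → TrivialUpTo N (geom a b)
trivialUpTo-geom N a b N<b i j j≤N =
  geom-off a b i j (λ k (_ , j≡) → ℕₚ.<⇒≱ N<b (ℕₚ.≤-trans (a≤a*[1+k] b k) (subst (_≤ N) j≡ j≤N)))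

RowUnit : Series → Set
RowUnit p = ∀ j → p 0 j ≡ 𝟙 0 j

rowUnit-⊛ : ∀ p r → RowUnit p → RowUnit r → RowUnit (p ⊛ r)
rowUnit-⊛ p r p₀≡1 r₀≡1 j = begin
  (p ⊛ r) 0 j ≡⟨ ⊛-cong≤ {p} {𝟙} {r} {r} 0 j (λ { zero j′ _ _ → p₀≡1 j′ }) (λ _ _ _ _ → refl) ⟩
  (𝟙 ⊛ r) 0 j ≡⟨ ⊛-identityˡ r 0 j ⟩
  r 0 j       ≡⟨ r₀≡1 j ⟩
  𝟙 0 j       ∎

rowUnit-∏< : ∀ N f → (∀ i → RowUnit (f i)) → RowUnit (∏< N f)
rowUnit-∏< zero f f-unit j = refl
rowUnit-∏< (suc N) f f-unit = rowUnit-⊛ (∏< N f) (f N) (rowUnit-∏< N f f-unit) (f-unit N)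

rowUnit-oneMinus : ∀ a b → RowUnit (oneMinus (suc a) b)
rowUnit-oneMinus a b j =
  trans (cong (λ x → 𝟙 0 j ℤ.- x) (mono-offˡ (suc a) b 0 j (λ ()))) (ℤₚ.+-identityʳ (𝟙 0 j))

rowUnit-geom : ∀ a b → RowUnit (geom (suc a) b)
rowUnit-geom a b j = geom-off (suc a) b 0 j (λ k (0≡ , _) → ℕₚ.1+n≢0 (sym 0≡))

⊛-rowUnit : ∀ p d m n → RowUnit p → (∀ i j → i < m → j ≤ n → d i j ≡ 0ℤ) → (p ⊛ d) m n ≡ d m n
⊛-rowUnit p d m n p₀≡1 d≡0 = begin
  Σ≤ m (λ i → Σ≤ n (λ j → p i j ℤ.* d (m ∸ i) (n ∸ j)))
    ≡⟨ Σ≤-single m 0 z≤n (λ i i≤m i≢0 → Σ≤-zero n (λ j _ →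
         *-absorbʳ (p i j) (d≡0 (m ∸ i) (n ∸ j) (m∸i<m i i≤m i≢0) (ℕₚ.m∸n≤m n j)))) ⟩
  Σ≤ n (λ j → p 0 j ℤ.* d m (n ∸ j))
    ≡⟨ Σ≤-single n 0 z≤n (λ j _ j≢0 → *-absorbˡ (d m (n ∸ j)) (trans (p₀≡1 j) (mono-offʳ 0 0 0 j j≢0))) ⟩
  p 0 0 ℤ.* d m n
    ≡⟨ cong (ℤ._* d m n) (p₀≡1 0) ⟩
  + 1 ℤ.* d m n
    ≡⟨ ℤₚ.*-identityˡ (d m n) ⟩
  d m n ∎
  where
  m∸i<m : ∀ i → i ≤ m → i ≢ 0 → m ∸ i < m
  m∸i<m zero _ 0≢0 = ⊥-elim (0≢0 refl)
  m∸i<m (suc i) (s≤s _) _ = s≤s (ℕₚ.m∸n≤m _ i)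

-- Once the rows below m vanish, row m of the equation reads d m n = d m (n - m).
σ-equation-unique : ∀ L R N d → RowUnit L → RowUnit R →
  (∀ n → n ≤ N → d 0 n ≡ 0ℤ) → (∀ m n → n ≤ N → (L ⊛ d) m n ≡ (R ⊛ σ d) m n) →
  ∀ m n → n ≤ N → d m n ≡ 0ℤ
σ-equation-unique L R N d L-unit R-unit d₀≡0 L[d]≡R[σd] = <-rec _ row
  where
  row : ∀ m → (∀ {k} → k < m → ∀ n → n ≤ N → d k n ≡ 0ℤ) → ∀ n → n ≤ N → d m n ≡ 0ℤ
  row zero _ = d₀≡0
  row (suc m) below = <-rec _ column
    where
    column : ∀ n → (∀ {k} → k < n → k ≤ N → d (suc m) k ≡ 0ℤ) → n ≤ N → d (suc m) n ≡ 0ℤ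
    column n left n≤N = begin
      d (suc m) n         ≡⟨ ⊛-rowUnit L d (suc m) n L-unit d-below ⟨
      (L ⊛ d) (suc m) n   ≡⟨ L[d]≡R[σd] (suc m) n n≤N ⟩
      (R ⊛ σ d) (suc m) n ≡⟨ ⊛-rowUnit R (σ d) (suc m) n R-unit σd-below ⟩
      σ d (suc m) n       ≡⟨ guard-zero (suc m ≤? n) (λ 1+m≤n → left (n∸1+m<n 1+m≤n) (n∸1+m≤N)) ⟩
      0ℤ                  ∎
      where
      d-below : ∀ i j → i < suc m → j ≤ n → d i j ≡ 0ℤ
      d-below i j i≤m j≤n = below i≤m j (ℕₚ.≤-trans j≤n n≤N)
      σd-below : ∀ i j → i < suc m → j ≤ n → σ d i j ≡ 0ℤ
      σd-below i j i≤m j≤n = guard-zero (i ≤? j) (λ _ → d-below i (j ∸ i) i≤m (ℕₚ.≤-trans (ℕₚ.m∸n≤m j i) j≤n))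
      n∸1+m<n : suc m ≤ n → n ∸ suc m < n
      n∸1+m<n 1+m≤n = ℕₚ.∸-monoʳ-< (s≤s z≤n) 1+m≤n
      n∸1+m≤N : n ∸ suc m ≤ N
      n∸1+m≤N = ℕₚ.≤-trans (ℕₚ.m∸n≤m n (suc m)) n≤N

∏<-σ-telescope : ∀ N f → (∀ i → σ (f i) ≐ f (suc i)) → f 0 ⊛ σ (∏< N f) ≐ ∏< N f ⊛ f N
∏<-σ-telescope N f σf≐ = ≐-trans (⊛-cong (≐-refl {f 0}) (≐-trans (σ-∏< N f) (∏<-cong N σf≐)))
                                 (≐-sym (∏<-unfoldˡ N f))

∏<-σ²-telescope : ∀ N f → (∀ i → σ (f i) ≐ f (2 + i)) →
  f 0 ⊛ (f 1 ⊛ σ (∏< N f)) ≐ (∏< N f ⊛ f N) ⊛ f (suc N)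
∏<-σ²-telescope N f σf≐ =
  ≐-trans (⊛-cong (≐-refl {f 0}) (⊛-cong (≐-refl {f 1}) (≐-trans (σ-∏< N f) (∏<-cong N σf≐))))
          (≐-trans (⊛-cong (≐-refl {f 0}) (≐-sym (∏<-unfoldˡ N (f ∘ suc)))) (≐-sym (∏<-unfoldˡ (suc N) f)))

numerator denominator₁ denominator₂ : ℕ → Series
numerator i = oneMinus 3 (6 + 3 ℕ.* i)
denominator₁ i = geom 1 (2 + i)
denominator₂ i = geom 2 (2 + i)

leftCoeff rightCoeff : Series
leftCoeff = oneMinus 1 2 ⊛ oneMinus 2 2 ⊛ oneMinus 2 3
rightCoeff = oneMinus 3 6

-- The factors of the infinite product beyond the truncation that σ brings into play.
overflow : ℕ → Series
overflow N = numerator N ⊛ denominator₁ N ⊛ denominator₂ N ⊛ denominator₂ (suc N)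

σ-numerator : ∀ i → σ (numerator i) ≐ numerator (suc i)
σ-numerator i = ≐-trans (σ-oneMinus 3 (6 + 3 ℕ.* i))
  (λ m n → cong (λ k → oneMinus 3 (6 + k) m n) (sym (ℕₚ.*-suc 3 i)))

σ-denominator₁ : ∀ i → σ (denominator₁ i) ≐ denominator₁ (suc i)
σ-denominator₁ i = σ-geom 1 (2 + i) (s≤s z≤n)

σ-denominator₂ : ∀ i → σ (denominator₂ i) ≐ denominator₂ (2 + i)
σ-denominator₂ i = σ-geom 2 (2 + i) (s≤s z≤n)

leftCoeff-cancels :
  (oneMinus 1 2 ⊛ denominator₁ 0) ⊛ (oneMinus 2 2 ⊛ denominator₂ 0) ⊛ (oneMinus 2 3 ⊛ denominator₂ 1) ≐ 𝟙
leftCoeff-cancels =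
  ≐-trans (⊛-cong (⊛-cong (geom-inverse 1 2 (s≤s z≤n)) (geom-inverse 2 2 (s≤s z≤n))) (geom-inverse 2 3 (s≤s z≤n)))
          (≐-trans (⊛-cong (⊛-identityˡ 𝟙) (≐-refl {𝟙})) (⊛-identityˡ 𝟙))

-- Each of the three products telescopes under σ; leftCoeff supplies the inverses of the
-- denominators that σ removes.
rhsTrunc-σ-equation : ∀ N → leftCoeff ⊛ rhsTrunc N ⊛ overflow N ≐ rightCoeff ⊛ σ (rhsTrunc N)
rhsTrunc-σ-equation N m n = sym (begin
  (rightCoeff ⊛ σ (A ⊛ (B ⊛ C))) m n
    ≡⟨ ⊛-cong (≐-refl {rightCoeff}) (≐-trans (σ-⊛ A (B ⊛ C)) (⊛-cong (≐-refl {σ A}) (σ-⊛ B C))) m n ⟩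
  (rightCoeff ⊛ σABC) m n
    ≡⟨ trans (⊛-cong (≐-refl {rightCoeff ⊛ σABC}) leftCoeff-cancels m n) (⊛-identityʳ (rightCoeff ⊛ σABC) m n) ⟨
  ((rightCoeff ⊛ σABC) ⊛ ((o₁ ⊛ b₀) ⊛ (o₂ ⊛ c₀) ⊛ (o₃ ⊛ c₁))) m n
    ≡⟨ regroup rightCoeff (σ A) (σ B) (σ C) o₁ o₂ o₃ b₀ c₀ c₁ m n ⟩
  ((rightCoeff ⊛ σ A) ⊛ (o₁ ⊛ (b₀ ⊛ σ B)) ⊛ ((o₂ ⊛ o₃) ⊛ (c₀ ⊛ (c₁ ⊛ σ C)))) m n
    ≡⟨ ⊛-cong (⊛-cong (∏<-σ-telescope N numerator σ-numerator)
                      (⊛-cong (≐-refl {o₁}) (∏<-σ-telescope N denominator₁ σ-denominator₁)))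
              (⊛-cong (≐-refl {o₂ ⊛ o₃}) (∏<-σ²-telescope N denominator₂ σ-denominator₂)) m n ⟩
  ((A ⊛ numerator N) ⊛ (o₁ ⊛ (B ⊛ denominator₁ N)) ⊛ ((o₂ ⊛ o₃) ⊛ ((C ⊛ denominator₂ N) ⊛ denominator₂ (suc N)))) m n
    ≡⟨ collect A B C (numerator N) (denominator₁ N) (denominator₂ N) (denominator₂ (suc N)) o₁ o₂ o₃ m n ⟩
  (leftCoeff ⊛ rhsTrunc N ⊛ overflow N) m n ∎)
  where
  A B C σABC o₁ o₂ o₃ b₀ c₀ c₁ : Series
  A = ∏< N numerator
  B = ∏< N denominator₁
  C = ∏< N denominator₂
  σABC = σ A ⊛ (σ B ⊛ σ C)
  o₁ = oneMinus 1 2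
  o₂ = oneMinus 2 2
  o₃ = oneMinus 2 3
  b₀ = denominator₁ 0
  c₀ = denominator₂ 0
  c₁ = denominator₂ 1
  open ⊛-Solver
  regroup : ∀ a sA sB sC u₁ u₂ u₃ v₀ w₀ w₁ →
    (a ⊛ (sA ⊛ (sB ⊛ sC))) ⊛ ((u₁ ⊛ v₀) ⊛ (u₂ ⊛ w₀) ⊛ (u₃ ⊛ w₁))
      ≐ (a ⊛ sA) ⊛ (u₁ ⊛ (v₀ ⊛ sB)) ⊛ ((u₂ ⊛ u₃) ⊛ (w₀ ⊛ (w₁ ⊛ sC)))
  regroup = solve 10 (λ a sA sB sC u₁ u₂ u₃ v₀ w₀ w₁ →
    (a :* (sA :* (sB :* sC))) :* ((u₁ :* v₀) :* (u₂ :* w₀) :* (u₃ :* w₁))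
      := (a :* sA) :* (u₁ :* (v₀ :* sB)) :* ((u₂ :* u₃) :* (w₀ :* (w₁ :* sC)))) ≐-refl
  collect : ∀ A B C a b c c′ u₁ u₂ u₃ →
    (A ⊛ a) ⊛ (u₁ ⊛ (B ⊛ b)) ⊛ ((u₂ ⊛ u₃) ⊛ ((C ⊛ c) ⊛ c′)) ≐ (u₁ ⊛ u₂ ⊛ u₃) ⊛ (A ⊛ (B ⊛ C)) ⊛ (a ⊛ b ⊛ c ⊛ c′)
  collect = solve 10 (λ A B C a b c c′ u₁ u₂ u₃ →
    (A :* a) :* (u₁ :* (B :* b)) :* ((u₂ :* u₃) :* ((C :* c) :* c′))
      := (u₁ :* u₂ :* u₃) :* (A :* (B :* C)) :* (a :* b :* c :* c′)) ≐-refl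

overflow-trivial : ∀ N → TrivialUpTo N (overflow N)
overflow-trivial N =
  trivialUpTo-⊛ N (numerator N ⊛ denominator₁ N ⊛ denominator₂ N) (denominator₂ (suc N))
    (trivialUpTo-⊛ N (numerator N ⊛ denominator₁ N) (denominator₂ N)
      (trivialUpTo-⊛ N (numerator N) (denominator₁ N)
        (trivialUpTo-oneMinus N 3 (6 + 3 ℕ.* N) (s≤s (ℕₚ.≤-trans (ℕₚ.m≤n+m N 5) (ℕₚ.+-monoʳ-≤ 5 (ℕₚ.m≤n*m N 3)))))
        (trivialUpTo-geom N 1 (2 + N) (s≤s (ℕₚ.m≤n+m N 1))))
      (trivialUpTo-geom N 2 (2 + N) (s≤s (ℕₚ.m≤n+m N 1))))
    (trivialUpTo-geom N 2 (3 + N) (s≤s (ℕₚ.m≤n+m N 2)))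

rhsTrunc-σ-equation≤ : ∀ N m n → n ≤ N → (leftCoeff ⊛ rhsTrunc N) m n ≡ (rightCoeff ⊛ σ (rhsTrunc N)) m n
rhsTrunc-σ-equation≤ N m n n≤N =
  trans (sym (⊛-trivialUpTo N (leftCoeff ⊛ rhsTrunc N) (overflow N) (overflow-trivial N) m n n≤N))
        (rhsTrunc-σ-equation N m n)

leftCoeff-rowUnit : RowUnit leftCoeff
leftCoeff-rowUnit = rowUnit-⊛ (oneMinus 1 2 ⊛ oneMinus 2 2) (oneMinus 2 3)
  (rowUnit-⊛ (oneMinus 1 2) (oneMinus 2 2) (rowUnit-oneMinus 0 2) (rowUnit-oneMinus 1 2)) (rowUnit-oneMinus 1 3)

rightCoeff-rowUnit : RowUnit rightCoeff
rightCoeff-rowUnit = rowUnit-oneMinus 2 6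

rhsTrunc-rowUnit : ∀ N → RowUnit (rhsTrunc N)
rhsTrunc-rowUnit N = rowUnit-⊛ (∏< N numerator) (∏< N denominator₁ ⊛ ∏< N denominator₂)
  (rowUnit-∏< N numerator (λ i → rowUnit-oneMinus 2 (6 + 3 ℕ.* i)))
  (rowUnit-⊛ (∏< N denominator₁) (∏< N denominator₂)
    (rowUnit-∏< N denominator₁ (λ i → rowUnit-geom 0 (2 + i))) (rowUnit-∏< N denominator₂ (λ i → rowUnit-geom 1 (2 + i))))

record Finite (A : Set) : Set where
  constructor finite
  field
    size : ℕ
    enum : Fin size ↔ A
open Finite public

finite-↔ : ∀ {A B : Set} → Finite A → A ↔ B → Finite B
finite-↔ (finite k e) A↔B = finite k (↔-trans e A↔B)

finite-⊎ : ∀ {A B : Set} → Finite A → Finite B → Finite (A ⊎ B)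
finite-⊎ (finite k e) (finite l f) = finite (k + l) (↔-trans Finₚ.+↔⊎ (e ⊎-↔ f))

finite-empty : ∀ {A : Set} → ¬ A → Finite A
finite-empty ¬a = finite 0 (mk↔ₛ′ (λ ()) (λ a → ⊥-elim (¬a a)) (λ a → ⊥-elim (¬a a)) (λ ()))

finite-singleton : ∀ {A : Set} (a : A) → (∀ x → x ≡ a) → Finite A
finite-singleton a unique =
  finite 1 (mk↔ₛ′ (λ _ → a) (λ _ → Fin.zero) (λ x → sym (unique x)) (λ { Fin.zero → refl ; (Fin.suc ()) }))

finite-guarded : ∀ {P A B : Set} → Dec P → (P → A ↔ B) → (¬ P → ¬ A) → Finite B → Finite A
finite-guarded (yes p) A↔B _ fin-B = finite-↔ fin-B (↔-sym (A↔B p))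
finite-guarded (no ¬p) _ ¬A _ = finite-empty (¬A ¬p)

size-↔ : ∀ {A B : Set} (c : Finite A) (d : Finite B) → A ↔ B → size c ≡ size d
size-↔ c d A↔B = ↔⇒≡ (↔-trans (enum c) (↔-trans A↔B (↔-sym (enum d))))

size-empty : ∀ {A : Set} (c : Finite A) → ¬ A → size c ≡ 0
size-empty c ¬a = size-↔ c (finite-empty ¬a) ↔-refl

size-⊎ : ∀ {A B C : Set} (c : Finite A) (d : Finite B) (e : Finite C) → A ↔ (B ⊎ C) → size c ≡ size d + size e
size-⊎ c d e = size-↔ c (finite-⊎ d e)

size-guarded : ∀ {P A B : Set} (p : Dec P) (c : Finite A) (d : Finite B) → (P → A ↔ B) → (¬ P → ¬ A) →
  + size c ≡ guard p (+ size d)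
size-guarded (yes p) c d A↔B _ = cong +_ (size-↔ c d (A↔B p))
size-guarded (no ¬p) c d _ ¬A = cong +_ (size-empty c (¬A ¬p))

Σ-≡-irrelevant : ∀ {A : Set} {P : A → Set} → (∀ a → Irrelevant (P a)) → {p q : Σ A P} → proj₁ p ≡ proj₁ q → p ≡ q
Σ-≡-irrelevant P-irr {a , p} {.a , q} refl = cong (a ,_) (P-irr a p q)

-- A 02-partition read backwards, from its last entry: the next entry must be at least l₁ and the
-- one after it at least l₂.  Part02 m n corresponds to RevPart 2 0 m n.
Admissible : ℕ → ℕ → List ℕ → Set
Admissible l₁ l₂ [] = ⊤
Admissible l₁ l₂ (a ∷ xs) = l₁ ≤ a × Admissible (l₂ ⊔ (a ∸ 2)) a xs

RevPart : ℕ → ℕ → ℕ → ℕ → Set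
RevPart l₁ l₂ m n = Σ[ xs ∈ List ℕ ] (length xs ≡ m × sum xs ≡ n × Admissible l₁ l₂ xs)

-- Cond02 with the bounds on the last two entries generalised as in Admissible.
Cond02′ : ℕ → ℕ → List ℕ → Set
Cond02′ l₁ l₂ [] = ⊤
Cond02′ l₁ l₂ (a ∷ []) = l₁ ≤ a
Cond02′ l₁ l₂ (a ∷ b ∷ []) = l₁ ≤ b × l₂ ⊔ (b ∸ 2) ≤ a
Cond02′ l₁ l₂ (a ∷ b ∷ c ∷ xs) = b ≤ a + 2 × c ≤ a × Cond02′ l₁ l₂ (b ∷ c ∷ xs)

∸2≤⇒≤+2 : ∀ a b → b ∸ 2 ≤ a → b ≤ a + 2
∸2≤⇒≤+2 a b b∸2≤a = ℕₚ.≤-trans (ℕₚ.m≤n+m∸n b 2) (subst (2 + (b ∸ 2) ≤_) (ℕₚ.+-comm 2 a) (ℕₚ.+-monoʳ-≤ 2 b∸2≤a))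

≤+2⇒∸2≤ : ∀ a b → b ≤ a + 2 → b ∸ 2 ≤ a
≤+2⇒∸2≤ a b b≤a+2 = ℕₚ.m≤n+o⇒m∸n≤o b 2 (subst (b ≤_) (ℕₚ.+-comm a 2) b≤a+2)

⊔∸2≤⇒ : ∀ l a b → l ⊔ (b ∸ 2) ≤ a → l ≤ a × b ≤ a + 2
⊔∸2≤⇒ l a b ≤a = ℕₚ.m⊔n≤o⇒m≤o l (b ∸ 2) ≤a , ∸2≤⇒≤+2 a b (ℕₚ.m⊔n≤o⇒n≤o l (b ∸ 2) ≤a)

⇒⊔∸2≤ : ∀ l a b → l ≤ a → b ≤ a + 2 → l ⊔ (b ∸ 2) ≤ a
⇒⊔∸2≤ l a b l≤a b≤a+2 = ℕₚ.⊔-lub l≤a (≤+2⇒∸2≤ a b b≤a+2)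

cond02⇒cond02′ : ∀ xs → Cond02 xs → Cond02′ 2 0 xs
cond02⇒cond02′ [] c = tt
cond02⇒cond02′ (a ∷ []) c = c
cond02⇒cond02′ (a ∷ b ∷ []) (b≤a+2 , 2≤b) = 2≤b , ≤+2⇒∸2≤ a b b≤a+2
cond02⇒cond02′ (a ∷ b ∷ c ∷ xs) (b≤a+2 , c≤a , rest) = b≤a+2 , c≤a , cond02⇒cond02′ (b ∷ c ∷ xs) rest

cond02′⇒cond02 : ∀ xs → Cond02′ 2 0 xs → Cond02 xs
cond02′⇒cond02 [] c = tt
cond02′⇒cond02 (a ∷ []) c = c
cond02′⇒cond02 (a ∷ b ∷ []) (2≤b , b∸2≤a) = ∸2≤⇒≤+2 a b b∸2≤a , 2≤b
cond02′⇒cond02 (a ∷ b ∷ c ∷ xs) (b≤a+2 , c≤a , rest) = b≤a+2 , c≤a , cond02′⇒cond02 (b ∷ c ∷ xs) rest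

cond02′-∷ʳ⁻ : ∀ l₁ l₂ xs x → Cond02′ l₁ l₂ (xs ∷ʳ x) → l₁ ≤ x × Cond02′ (l₂ ⊔ (x ∸ 2)) x xs
cond02′-∷ʳ⁻ l₁ l₂ [] x c = c , tt
cond02′-∷ʳ⁻ l₁ l₂ (a ∷ []) x c = c
cond02′-∷ʳ⁻ l₁ l₂ (a ∷ b ∷ []) x (b≤a+2 , x≤a , l₁≤x , ≤b) = l₁≤x , ≤b , ⇒⊔∸2≤ x a b x≤a b≤a+2
cond02′-∷ʳ⁻ l₁ l₂ (a ∷ b ∷ c ∷ xs) x (b≤a+2 , c≤a , rest) =
  let l₁≤x , rest′ = cond02′-∷ʳ⁻ l₁ l₂ (b ∷ c ∷ xs) x rest in l₁≤x , b≤a+2 , c≤a , rest′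

cond02′-∷ʳ⁺ : ∀ l₁ l₂ xs x → l₁ ≤ x → Cond02′ (l₂ ⊔ (x ∸ 2)) x xs → Cond02′ l₁ l₂ (xs ∷ʳ x)
cond02′-∷ʳ⁺ l₁ l₂ [] x l₁≤x c = l₁≤x
cond02′-∷ʳ⁺ l₁ l₂ (a ∷ []) x l₁≤x c = l₁≤x , c
cond02′-∷ʳ⁺ l₁ l₂ (a ∷ b ∷ []) x l₁≤x (≤b , ≤a) = let x≤a , b≤a+2 = ⊔∸2≤⇒ x a b ≤a in b≤a+2 , x≤a , l₁≤x , ≤b
cond02′-∷ʳ⁺ l₁ l₂ (a ∷ b ∷ c ∷ xs) x l₁≤x (b≤a+2 , c≤a , rest) = b≤a+2 , c≤a , cond02′-∷ʳ⁺ l₁ l₂ (b ∷ c ∷ xs) x l₁≤x rest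

cond02′-reverse⇒admissible : ∀ l₁ l₂ xs → Cond02′ l₁ l₂ (reverse xs) → Admissible l₁ l₂ xs
cond02′-reverse⇒admissible l₁ l₂ [] c = tt
cond02′-reverse⇒admissible l₁ l₂ (x ∷ xs) c =
  let l₁≤x , c′ = cond02′-∷ʳ⁻ l₁ l₂ (reverse xs) x (subst (Cond02′ l₁ l₂) (Listₚ.unfold-reverse x xs) c)
  in l₁≤x , cond02′-reverse⇒admissible (l₂ ⊔ (x ∸ 2)) x xs c′

admissible⇒cond02′-reverse : ∀ l₁ l₂ xs → Admissible l₁ l₂ xs → Cond02′ l₁ l₂ (reverse xs)
admissible⇒cond02′-reverse l₁ l₂ [] _ = tt
admissible⇒cond02′-reverse l₁ l₂ (x ∷ xs) (l₁≤x , adm) = subst (Cond02′ l₁ l₂) (sym (Listₚ.unfold-reverse x xs))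
  (cond02′-∷ʳ⁺ l₁ l₂ (reverse xs) x l₁≤x (admissible⇒cond02′-reverse (l₂ ⊔ (x ∸ 2)) x xs adm))

admissible-irrelevant : ∀ l₁ l₂ xs → Irrelevant (Admissible l₁ l₂ xs)
admissible-irrelevant l₁ l₂ [] tt tt = refl
admissible-irrelevant l₁ l₂ (a ∷ xs) (p , adm) (q , adm′) =
  cong₂ _,_ (ℕₚ.≤-irrelevant p q) (admissible-irrelevant _ a xs adm adm′)

cond02-irrelevant : ∀ xs → Irrelevant (Cond02 xs)
cond02-irrelevant [] tt tt = refl
cond02-irrelevant (a ∷ []) = ℕₚ.≤-irrelevant
cond02-irrelevant (a ∷ b ∷ []) (p , q) (p′ , q′) = cong₂ _,_ (ℕₚ.≤-irrelevant p p′) (ℕₚ.≤-irrelevant q q′)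
cond02-irrelevant (a ∷ b ∷ c ∷ xs) (p , q , c₁) (p′ , q′ , c₂) =
  cong₂ _,_ (ℕₚ.≤-irrelevant p p′) (cong₂ _,_ (ℕₚ.≤-irrelevant q q′) (cond02-irrelevant (b ∷ c ∷ xs) c₁ c₂))

×-irrelevant : ∀ {A B : Set} → Irrelevant A → Irrelevant B → Irrelevant (A × B)
×-irrelevant A-irr B-irr (a , b) (a′ , b′) = cong₂ _,_ (A-irr a a′) (B-irr b b′)

revPart-≡ : ∀ {l₁ l₂ m n} {p q : RevPart l₁ l₂ m n} → proj₁ p ≡ proj₁ q → p ≡ q
revPart-≡ = Σ-≡-irrelevant (λ xs →
  ×-irrelevant ℕₚ.≡-irrelevant (×-irrelevant ℕₚ.≡-irrelevant (admissible-irrelevant _ _ xs)))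

Part02↔RevPart : ∀ m n → Part02 m n ↔ RevPart 2 0 m n
Part02↔RevPart m n = mk↔ₛ′ to from (λ _ → revPart-≡ (Listₚ.reverse-involutive _)) from∘to
  where
  to : Part02 m n → RevPart 2 0 m n
  to (xs , len , total , c) =
    reverse xs , trans (Listₚ.length-reverse xs) len , trans (Sumₚ.sum-↭ (↭-reverse xs)) total ,
    cond02′-reverse⇒admissible 2 0 (reverse xs) (subst (Cond02′ 2 0) (sym (Listₚ.reverse-involutive xs)) (cond02⇒cond02′ xs c))
  from : RevPart 2 0 m n → Part02 m n
  from (xs , len , total , adm) =
    reverse xs , trans (Listₚ.length-reverse xs) len , trans (Sumₚ.sum-↭ (↭-reverse xs)) total ,
    cond02′⇒cond02 (reverse xs) (admissible⇒cond02′-reverse 2 0 xs adm)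
  from∘to : ∀ p → from (to p) ≡ p
  from∘to (xs , _) = Σ-≡-irrelevant (λ ys →
    ×-irrelevant ℕₚ.≡-irrelevant (×-irrelevant ℕₚ.≡-irrelevant (cond02-irrelevant ys))) (Listₚ.reverse-involutive xs)

HeadExactly : ℕ → ℕ → ℕ → ℕ → Set
HeadExactly l₁ l₂ m n = Σ[ xs ∈ List ℕ ] (length xs ≡ m × l₁ + sum xs ≡ n × Admissible (l₂ ⊔ (l₁ ∸ 2)) l₁ xs)

module _ (l₁ l₂ m n : ℕ) where

  private
    classify : ∀ a xs → length (a ∷ xs) ≡ suc m → sum (a ∷ xs) ≡ n → l₁ ≤ a → Admissible (l₂ ⊔ (a ∸ 2)) a xs →
      Dec (l₁ ≡ a) → HeadExactly l₁ l₂ m n ⊎ RevPart (suc l₁) l₂ (suc m) n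
    classify a xs len total l₁≤a adm (yes refl) = inj₁ (xs , ℕₚ.suc-injective len , total , adm)
    classify a xs len total l₁≤a adm (no l₁≢a) = inj₂ (a ∷ xs , len , total , ℕₚ.≤∧≢⇒< l₁≤a l₁≢a , adm)

    to : RevPart l₁ l₂ (suc m) n → HeadExactly l₁ l₂ m n ⊎ RevPart (suc l₁) l₂ (suc m) n
    to (a ∷ xs , len , total , l₁≤a , adm) = classify a xs len total l₁≤a adm (l₁ ℕₚ.≟ a)

    from : HeadExactly l₁ l₂ m n ⊎ RevPart (suc l₁) l₂ (suc m) n → RevPart l₁ l₂ (suc m) n
    from (inj₁ (xs , len , total , adm)) = l₁ ∷ xs , cong suc len , total , ℕₚ.≤-refl , adm
    from (inj₂ (a ∷ xs , len , total , l₁<a , adm)) = a ∷ xs , len , total , ℕₚ.<⇒≤ l₁<a , adm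

    to∘from : ∀ p → to (from p) ≡ p
    to∘from (inj₁ (xs , len , total , adm)) with l₁ ℕₚ.≟ l₁
    ... | yes refl = cong (λ len′ → inj₁ (xs , len′ , total , adm)) (ℕₚ.≡-irrelevant _ _)
    ... | no l₁≢l₁ = ⊥-elim (l₁≢l₁ refl)
    to∘from (inj₂ (a ∷ xs , len , total , l₁<a , adm)) with l₁ ℕₚ.≟ a
    ... | yes refl = ⊥-elim (ℕₚ.<-irrefl refl l₁<a)
    ... | no _ = cong (λ l₁<a′ → inj₂ (a ∷ xs , len , total , l₁<a′ , adm)) (ℕₚ.<-irrelevant _ _)

    from∘to : ∀ p → from (to p) ≡ p
    from∘to (a ∷ xs , len , total , l₁≤a , adm) with l₁ ℕₚ.≟ a
    ... | yes refl = revPart-≡ refl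
    ... | no _ = revPart-≡ refl

  RevPart-head↔ : RevPart l₁ l₂ (suc m) n ↔ (HeadExactly l₁ l₂ m n ⊎ RevPart (suc l₁) l₂ (suc m) n)
  RevPart-head↔ = mk↔ₛ′ to from to∘from from∘to

HeadExactly↔ : ∀ l₁ l₂ m n → l₁ ≤ n → HeadExactly l₁ l₂ m n ↔ RevPart (l₂ ⊔ (l₁ ∸ 2)) l₁ m (n ∸ l₁)
HeadExactly↔ l₁ l₂ m n l₁≤n = mk↔ₛ′ to from (λ _ → revPart-≡ refl) (λ _ → Σ-≡-irrelevant irrelevant refl)
  where
  to : HeadExactly l₁ l₂ m n → RevPart (l₂ ⊔ (l₁ ∸ 2)) l₁ m (n ∸ l₁)
  to (xs , len , total , adm) = xs , len , trans (sym (ℕₚ.m+n∸m≡n l₁ (sum xs))) (cong (_∸ l₁) total) , adm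
  from : RevPart (l₂ ⊔ (l₁ ∸ 2)) l₁ m (n ∸ l₁) → HeadExactly l₁ l₂ m n
  from (xs , len , total , adm) = xs , len , trans (cong (_+_ l₁) total) (ℕₚ.m+[n∸m]≡n l₁≤n) , adm
  irrelevant : ∀ xs → Irrelevant (length xs ≡ m × l₁ + sum xs ≡ n × Admissible (l₂ ⊔ (l₁ ∸ 2)) l₁ xs)
  irrelevant xs = ×-irrelevant ℕₚ.≡-irrelevant (×-irrelevant ℕₚ.≡-irrelevant (admissible-irrelevant _ _ xs))

HeadExactly-empty : ∀ l₁ l₂ m n → ¬ l₁ ≤ n → ¬ HeadExactly l₁ l₂ m n
HeadExactly-empty l₁ l₂ m n l₁≰n (xs , _ , total , _) = l₁≰n (subst (l₁ ≤_) total (ℕₚ.m≤m+n l₁ (sum xs)))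

suc-⊔-∸2 : ∀ l a → suc l ⊔ (suc a ∸ 2) ≡ suc (l ⊔ (a ∸ 2))
suc-⊔-∸2 l zero = cong suc (sym (ℕₚ.⊔-identityʳ l))
suc-⊔-∸2 l (suc zero) = cong suc (sym (ℕₚ.⊔-identityʳ l))
suc-⊔-∸2 l (suc (suc a)) = refl

admissible-map-suc⁺ : ∀ l₁ l₂ xs → Admissible l₁ l₂ xs → Admissible (suc l₁) (suc l₂) (map suc xs)
admissible-map-suc⁺ l₁ l₂ [] _ = tt
admissible-map-suc⁺ l₁ l₂ (a ∷ xs) (l₁≤a , adm) =
  s≤s l₁≤a , subst (λ l → Admissible l (suc a) (map suc xs)) (sym (suc-⊔-∸2 l₂ a)) (admissible-map-suc⁺ _ a xs adm)

admissible-map-suc⁻ : ∀ l₁ l₂ xs → Admissible (suc l₁) (suc l₂) (map suc xs) → Admissible l₁ l₂ xs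
admissible-map-suc⁻ l₁ l₂ [] _ = tt
admissible-map-suc⁻ l₁ l₂ (a ∷ xs) (s≤s l₁≤a , adm) =
  l₁≤a , admissible-map-suc⁻ _ a xs (subst (λ l → Admissible l (suc a) (map suc xs)) (suc-⊔-∸2 l₂ a) adm)

admissible-suc⇒map-suc-pred : ∀ l₁ l₂ xs → Admissible (suc l₁) (suc l₂) xs → map suc (map pred xs) ≡ xs
admissible-suc⇒map-suc-pred l₁ l₂ [] _ = refl
admissible-suc⇒map-suc-pred l₁ l₂ (suc a ∷ xs) (s≤s _ , adm) =
  cong (suc a ∷_) (admissible-suc⇒map-suc-pred _ a xs (subst (λ l → Admissible l (suc a) xs) (suc-⊔-∸2 l₂ a) adm))

sum-map-suc : ∀ xs → sum (map suc xs) ≡ length xs + sum xs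
sum-map-suc [] = refl
sum-map-suc (a ∷ xs) = cong suc (begin
  a + sum (map suc xs)      ≡⟨ cong (_+_ a) (sum-map-suc xs) ⟩
  a + (length xs + sum xs)  ≡⟨ ℕₚ.+-assoc a (length xs) (sum xs) ⟨
  (a + length xs) + sum xs  ≡⟨ cong (_+ sum xs) (ℕₚ.+-comm a (length xs)) ⟩
  (length xs + a) + sum xs  ≡⟨ ℕₚ.+-assoc (length xs) a (sum xs) ⟩
  length xs + (a + sum xs)  ∎)

admissible-suc⇒sum : ∀ l₁ l₂ xs → Admissible (suc l₁) (suc l₂) xs → length xs + sum (map pred xs) ≡ sum xs
admissible-suc⇒sum l₁ l₂ xs adm = begin
  length xs + sum (map pred xs)               ≡⟨ cong (_+ sum (map pred xs)) (Listₚ.length-map pred xs) ⟨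
  length (map pred xs) + sum (map pred xs)    ≡⟨ sum-map-suc (map pred xs) ⟨
  sum (map suc (map pred xs))                 ≡⟨ cong sum (admissible-suc⇒map-suc-pred l₁ l₂ xs adm) ⟩
  sum xs                                      ∎

RevPart-pred↔ : ∀ l₁ l₂ m n → m ≤ n → RevPart (suc l₁) (suc l₂) m n ↔ RevPart l₁ l₂ m (n ∸ m)
RevPart-pred↔ l₁ l₂ m n m≤n = mk↔ₛ′ to from
  (λ (xs , _) → revPart-≡ (trans (sym (Listₚ.map-∘ xs)) (Listₚ.map-id xs)))
  (λ (xs , _ , _ , adm) → revPart-≡ (admissible-suc⇒map-suc-pred l₁ l₂ xs adm))
  where
  to : RevPart (suc l₁) (suc l₂) m n → RevPart l₁ l₂ m (n ∸ m)
  to (xs , len , total , adm) =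
    map pred xs , trans (Listₚ.length-map pred xs) len ,
    trans (sym (ℕₚ.m+n∸m≡n m (sum (map pred xs)))) (cong (_∸ m) m+Σ≡n) ,
    admissible-map-suc⁻ l₁ l₂ (map pred xs)
      (subst (Admissible (suc l₁) (suc l₂)) (sym (admissible-suc⇒map-suc-pred l₁ l₂ xs adm)) adm)
    where
    m+Σ≡n : m + sum (map pred xs) ≡ n
    m+Σ≡n = trans (cong (_+ sum (map pred xs)) (sym len)) (trans (admissible-suc⇒sum l₁ l₂ xs adm) total)
  from : RevPart l₁ l₂ m (n ∸ m) → RevPart (suc l₁) (suc l₂) m n
  from (xs , len , total , adm) =
    map suc xs , trans (Listₚ.length-map suc xs) len ,
    trans (sum-map-suc xs) (trans (cong₂ _+_ len total) (ℕₚ.m+[n∸m]≡n m≤n)) , admissible-map-suc⁺ l₁ l₂ xs adm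

RevPart-suc-empty : ∀ l₁ l₂ m n → ¬ m ≤ n → ¬ RevPart (suc l₁) (suc l₂) m n
RevPart-suc-empty l₁ l₂ m n m≰n (xs , refl , refl , adm) =
  m≰n (subst (length xs ≤_) (admissible-suc⇒sum l₁ l₂ xs adm) (ℕₚ.m≤m+n (length xs) (sum (map pred xs))))

-- Once the next entry is at least l₁, a bound l₂ ≤ l₁ - 2 on the entry after it is automatic.
admissible-≤∸2 : ∀ {l₁ l₂ l₂′} xs → l₂ ≤ l₁ ∸ 2 → l₂′ ≤ l₁ ∸ 2 → Admissible l₁ l₂ xs → Admissible l₁ l₂′ xs
admissible-≤∸2 [] _ _ _ = tt
admissible-≤∸2 {l₁} {l₂} {l₂′} (a ∷ xs) l₂≤ l₂′≤ (l₁≤a , adm) =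
  l₁≤a , subst (λ l → Admissible l a xs) (trans (absorb l₂≤) (sym (absorb l₂′≤))) adm
  where
  absorb : ∀ {l} → l ≤ l₁ ∸ 2 → l ⊔ (a ∸ 2) ≡ a ∸ 2
  absorb l≤ = ℕₚ.m≤n⇒m⊔n≡n (ℕₚ.≤-trans l≤ (ℕₚ.∸-monoˡ-≤ 2 l₁≤a))

RevPart-≤∸2↔ : ∀ {l₁ l₂ l₂′} m n → l₂ ≤ l₁ ∸ 2 → l₂′ ≤ l₁ ∸ 2 → RevPart l₁ l₂ m n ↔ RevPart l₁ l₂′ m n
RevPart-≤∸2↔ m n l₂≤ l₂′≤ = mk↔ₛ′
  (λ (xs , len , total , adm) → xs , len , total , admissible-≤∸2 xs l₂≤ l₂′≤ adm)
  (λ (xs , len , total , adm) → xs , len , total , admissible-≤∸2 xs l₂′≤ l₂≤ adm)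
  (λ _ → revPart-≡ refl) (λ _ → revPart-≡ refl)

RevPart-length0↔ : ∀ {l₁ l₂ l₁′ l₂′} n → RevPart l₁ l₂ 0 n ↔ RevPart l₁′ l₂′ 0 n
RevPart-length0↔ n = mk↔ₛ′
  (λ { ([] , len , total , tt) → [] , len , total , tt })
  (λ { ([] , len , total , tt) → [] , len , total , tt })
  (λ { ([] , _ , _ , tt) → refl })
  (λ { ([] , _ , _ , tt) → refl })

revPart-finite : ∀ m l₁ l₂ n → Finite (RevPart l₁ l₂ m n)
revPart-finite zero l₁ l₂ zero = finite-singleton ([] , refl , refl , tt) (λ { ([] , refl , refl , tt) → refl })
revPart-finite zero l₁ l₂ (suc n) = finite-empty (λ { ([] , _ , () , _) })
revPart-finite (suc m) l₁ l₂ n = from-head (suc n) l₁ (ℕₚ.m≤m+n (suc n) l₁)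
  where
  -- Recursion on the number g of candidate values for the head.
  from-head : ∀ g l → n < g + l → Finite (RevPart l l₂ (suc m) n)
  from-head zero l n<l = finite-empty λ where
    (a ∷ xs , _ , total , l≤a , _) → ℕₚ.<⇒≱ n<l (ℕₚ.≤-trans l≤a (subst (a ≤_) total (ℕₚ.m≤m+n a (sum xs))))
  from-head (suc g) l n<g+l = finite-↔
    (finite-⊎ (finite-guarded (l ≤? n) (HeadExactly↔ l l₂ m n) (HeadExactly-empty l l₂ m n)
                              (revPart-finite m (l₂ ⊔ (l ∸ 2)) l (n ∸ l)))
              (from-head g (suc l) (subst (n <_) (sym (ℕₚ.+-suc g l)) n<g+l)))
    (↔-sym (RevPart-head↔ l l₂ m n))

-- The functional equation of the counting series

count : ℕ → ℕ → ℕ → ℕ → ℕ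
count l₁ l₂ m n = size (revPart-finite m l₁ l₂ n)

GF : ℕ → ℕ → Series
GF l₁ l₂ m n = + count l₁ l₂ m n

GF-length0 : ∀ l₁ l₂ n → GF l₁ l₂ 0 n ≡ 𝟙 0 n
GF-length0 l₁ l₂ zero =
  cong +_ (size-↔ (revPart-finite 0 l₁ l₂ 0) (revPart-finite 0 0 0 0) (RevPart-length0↔ 0))
GF-length0 l₁ l₂ (suc n) =
  cong +_ (size-↔ (revPart-finite 0 l₁ l₂ (suc n)) (revPart-finite 0 0 0 (suc n)) (RevPart-length0↔ (suc n)))

GF-head : ∀ l₁ l₂ → GF l₁ l₂ ≐ mono 1 l₁ ⊛ GF (l₂ ⊔ (l₁ ∸ 2)) l₁ ⊞ GF (suc l₁) l₂
GF-head l₁ l₂ zero n = begin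
  GF l₁ l₂ 0 n
    ≡⟨ cong +_ (size-↔ (revPart-finite 0 l₁ l₂ n) (revPart-finite 0 (suc l₁) l₂ n) (RevPart-length0↔ n)) ⟩
  GF (suc l₁) l₂ 0 n
    ≡⟨ ℤₚ.+-identityˡ _ ⟨
  0ℤ ℤ.+ GF (suc l₁) l₂ 0 n
    ≡⟨ cong (ℤ._+ GF (suc l₁) l₂ 0 n) (mono-⊛ 1 l₁ (GF (l₂ ⊔ (l₁ ∸ 2)) l₁) 0 n) ⟨
  (mono 1 l₁ ⊛ GF (l₂ ⊔ (l₁ ∸ 2)) l₁ ⊞ GF (suc l₁) l₂) 0 n ∎
GF-head l₁ l₂ (suc m) n = begin
  + count l₁ l₂ (suc m) n
    ≡⟨ cong +_ (size-⊎ (revPart-finite (suc m) l₁ l₂ n) head-finite (revPart-finite (suc m) (suc l₁) l₂ n)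
                       (RevPart-head↔ l₁ l₂ m n)) ⟩
  + (size head-finite + count (suc l₁) l₂ (suc m) n)
    ≡⟨ ℤₚ.pos-+ (size head-finite) (count (suc l₁) l₂ (suc m) n) ⟩
  + size head-finite ℤ.+ GF (suc l₁) l₂ (suc m) n
    ≡⟨ cong (ℤ._+ GF (suc l₁) l₂ (suc m) n) (size-guarded (l₁ ≤? n) head-finite tail-finite
                                                  (HeadExactly↔ l₁ l₂ m n) (HeadExactly-empty l₁ l₂ m n)) ⟩
  guard (l₁ ≤? n) (GF (l₂ ⊔ (l₁ ∸ 2)) l₁ m (n ∸ l₁)) ℤ.+ GF (suc l₁) l₂ (suc m) n
    ≡⟨ cong (ℤ._+ GF (suc l₁) l₂ (suc m) n) (mono-⊛ 1 l₁ (GF (l₂ ⊔ (l₁ ∸ 2)) l₁) (suc m) n) ⟨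
  (mono 1 l₁ ⊛ GF (l₂ ⊔ (l₁ ∸ 2)) l₁ ⊞ GF (suc l₁) l₂) (suc m) n ∎
  where
  tail-finite : Finite (RevPart (l₂ ⊔ (l₁ ∸ 2)) l₁ m (n ∸ l₁))
  tail-finite = revPart-finite m (l₂ ⊔ (l₁ ∸ 2)) l₁ (n ∸ l₁)
  head-finite : Finite (HeadExactly l₁ l₂ m n)
  head-finite = finite-guarded (l₁ ≤? n) (HeadExactly↔ l₁ l₂ m n) (HeadExactly-empty l₁ l₂ m n) tail-finite

GF-shift : ∀ l₁ l₂ → GF (suc l₁) (suc l₂) ≐ σ (GF l₁ l₂)
GF-shift l₁ l₂ m n = size-guarded (m ≤? n) (revPart-finite m (suc l₁) (suc l₂) n) (revPart-finite m l₁ l₂ (n ∸ m))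
  (RevPart-pred↔ l₁ l₂ m n) (RevPart-suc-empty l₁ l₂ m n)

GF-≤∸2 : ∀ {l₁ l₂ l₂′} → l₂ ≤ l₁ ∸ 2 → l₂′ ≤ l₁ ∸ 2 → GF l₁ l₂ ≐ GF l₁ l₂′
GF-≤∸2 {l₁} {l₂} {l₂′} l₂≤ l₂′≤ m n =
  cong +_ (size-↔ (revPart-finite m l₁ l₂ n) (revPart-finite m l₁ l₂′ n) (RevPart-≤∸2↔ m n l₂≤ l₂′≤))

infixr 8 _^_
_^_ : Series → ℕ → Series
f ^ zero = 𝟙
f ^ suc k = f ⊛ f ^ k

residual : Series → Series → Series → Series
residual F A B = F ⊞ ⊟ (A ⊞ B)

residual-vanishes : ∀ {F A B} → F ≐ A ⊞ B → residual F A B ≐ 𝟘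
residual-vanishes {F} {A} {B} F≐ m n =
  trans (cong (λ x → x ℤ.- (A m n ℤ.+ B m n)) (F≐ m n)) (ℤₚ.+-inverseʳ (A m n ℤ.+ B m n))

-- A certificate that the target identity lies in the ideal generated by the eight relations.
elimination-certificate : ∀ z q G X σG σX σY σU σ²G σ²Y σ²U σ²V →
  let Z : ℕ → ℕ → Series
      Z a b = z ^ a ⊛ q ^ b
      c : Series
      c = (𝟙 ⊞ ⊟ Z 1 2) ⊛ (𝟙 ⊞ ⊟ Z 2 3)
  in (𝟙 ⊞ ⊟ Z 1 2) ⊛ (𝟙 ⊞ ⊟ Z 2 2) ⊛ (𝟙 ⊞ ⊟ Z 2 3) ⊛ G ⊞ ⊟ ((𝟙 ⊞ ⊟ Z 3 6) ⊛ σG)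
     ≐ c ⊛ residual G (Z 1 2 ⊛ X) σG
     ⊞ c ⊛ Z 1 2 ⊛ residual X (Z 1 0 ⊛ G) σY
     ⊞ Z 1 2 ⊛ (𝟙 ⊞ ⊟ Z 1 2) ⊛ residual σY (Z 1 1 ⊛ σU) σ²V
     ⊞ Z 1 2 ⊛ (𝟙 ⊞ ⊟ Z 1 2) ⊛ Z 1 1 ⊛ residual σU (Z 1 2 ⊛ σY) σG
     ⊞ Z 1 2 ⊛ residual σ²V (Z 1 2 ⊛ σ²V) σ²U
     ⊞ Z 1 2 ⊛ residual σ²U (Z 1 3 ⊛ σ²Y) σ²G
     ⊞ ⊟ Z 1 2 ⊛ residual σG (Z 1 3 ⊛ σX) σ²G
     ⊞ ⊟ (Z 1 2 ⊛ Z 1 3) ⊛ residual σX (Z 1 1 ⊛ σG) σ²Y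
elimination-certificate = solve 12 (λ z q G X σG σX σY σU σ²G σ²Y σ²U σ²V →
  let Z : ℕ → ℕ → Polynomial 12
      Z a b = z :^ a :* q :^ b
      res : Polynomial 12 → Polynomial 12 → Polynomial 12 → Polynomial 12
      res F A B = F :- (A :+ B)
      one : Polynomial 12
      one = con (+ 1)
      c : Polynomial 12
      c = (one :- Z 1 2) :* (one :- Z 2 3)
  in (one :- Z 1 2) :* (one :- Z 2 2) :* (one :- Z 2 3) :* G :- (one :- Z 3 6) :* σG
     := c :* res G (Z 1 2 :* X) σG
     :+ c :* Z 1 2 :* res X (Z 1 0 :* G) σY
     :+ Z 1 2 :* (one :- Z 1 2) :* res σY (Z 1 1 :* σU) σ²V
     :+ Z 1 2 :* (one :- Z 1 2) :* Z 1 1 :* res σU (Z 1 2 :* σY) σG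
     :+ Z 1 2 :* res σ²V (Z 1 2 :* σ²V) σ²U
     :+ Z 1 2 :* res σ²U (Z 1 3 :* σ²Y) σ²G
     :+ :- Z 1 2 :* res σG (Z 1 3 :* σX) σ²G
     :+ :- (Z 1 2 :* Z 1 3) :* res σX (Z 1 1 :* σG) σ²Y) ≐-refl
  where open ⊛-Solver

⊞-vanishes : ∀ {f g} → f ≐ 𝟘 → g ≐ 𝟘 → f ⊞ g ≐ 𝟘
⊞-vanishes f≐0 g≐0 m n = cong₂ ℤ._+_ (f≐0 m n) (g≐0 m n)

⊛-vanishes : ∀ c {r} → r ≐ 𝟘 → c ⊛ r ≐ 𝟘
⊛-vanishes c r≐0 m n = Σ≤-zero m (λ i _ → Σ≤-zero n (λ j _ → *-absorbʳ (c i j) (r≐0 (m ∸ i) (n ∸ j))))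

relations⇒σ-equation : ∀ z q G X σG σX σY σU σ²G σ²Y σ²U σ²V →
  let Z : ℕ → ℕ → Series
      Z a b = z ^ a ⊛ q ^ b
  in G ≐ Z 1 2 ⊛ X ⊞ σG → X ≐ Z 1 0 ⊛ G ⊞ σY →
     σY ≐ Z 1 1 ⊛ σU ⊞ σ²V → σU ≐ Z 1 2 ⊛ σY ⊞ σG → σ²V ≐ Z 1 2 ⊛ σ²V ⊞ σ²U → σ²U ≐ Z 1 3 ⊛ σ²Y ⊞ σ²G →
     σG ≐ Z 1 3 ⊛ σX ⊞ σ²G → σX ≐ Z 1 1 ⊛ σG ⊞ σ²Y →
     (𝟙 ⊞ ⊟ Z 1 2) ⊛ (𝟙 ⊞ ⊟ Z 2 2) ⊛ (𝟙 ⊞ ⊟ Z 2 3) ⊛ G ≐ (𝟙 ⊞ ⊟ Z 3 6) ⊛ σG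
relations⇒σ-equation z q G X σG σX σY σU σ²G σ²Y σ²U σ²V r₁ r₂ r₃ r₄ r₅ r₆ r₇ r₈ m n =
  ℤₚ.i-j≡0⇒i≡j _ _ (trans (elimination-certificate z q G X σG σX σY σU σ²G σ²Y σ²U σ²V m n)
    (⊞-vanishes (⊞-vanishes (⊞-vanishes (⊞-vanishes (⊞-vanishes (⊞-vanishes (⊞-vanishes
      (⊛-vanishes c (residual-vanishes {G} {Z 1 2 ⊛ X} {σG} r₁))
      (⊛-vanishes (c ⊛ Z 1 2) (residual-vanishes {X} {Z 1 0 ⊛ G} {σY} r₂)))
      (⊛-vanishes (Z 1 2 ⊛ (𝟙 ⊞ ⊟ Z 1 2)) (residual-vanishes {σY} {Z 1 1 ⊛ σU} {σ²V} r₃)))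
      (⊛-vanishes (Z 1 2 ⊛ (𝟙 ⊞ ⊟ Z 1 2) ⊛ Z 1 1) (residual-vanishes {σU} {Z 1 2 ⊛ σY} {σG} r₄)))
      (⊛-vanishes (Z 1 2) (residual-vanishes {σ²V} {Z 1 2 ⊛ σ²V} {σ²U} r₅)))
      (⊛-vanishes (Z 1 2) (residual-vanishes {σ²U} {Z 1 3 ⊛ σ²Y} {σ²G} r₆)))
      (⊛-vanishes (⊟ Z 1 2) (residual-vanishes {σG} {Z 1 3 ⊛ σX} {σ²G} r₇)))
      (⊛-vanishes (⊟ (Z 1 2 ⊛ Z 1 3)) (residual-vanishes {σX} {Z 1 1 ⊛ σG} {σ²Y} r₈)) m n))
  where
  Z : ℕ → ℕ → Series
  Z a b = z ^ a ⊛ q ^ b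
  c : Series
  c = (𝟙 ⊞ ⊟ Z 1 2) ⊛ (𝟙 ⊞ ⊟ Z 2 3)

z q : Series
z = mono 1 0
q = mono 0 1

mono-suc-z : ∀ a b → mono (suc a) b ≐ z ⊛ mono a b
mono-suc-z a b zero n = sym (mono-⊛ 1 0 (mono a b) 0 n)
mono-suc-z a b (suc m) n = trans
  ([]-cong ((suc m ℕₚ.≟ suc a) ×-dec (n ℕₚ.≟ b)) ((m ℕₚ.≟ a) ×-dec (n ℕₚ.≟ b))
           (λ (m≡a , n≡b) → ℕₚ.suc-injective m≡a , n≡b) (λ (m≡a , n≡b) → cong suc m≡a , n≡b))
  (sym (mono-⊛ 1 0 (mono a b) (suc m) n))

mono-suc-q : ∀ a b → mono a (suc b) ≐ q ⊛ mono a b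
mono-suc-q a b m zero = trans (mono-offʳ a (suc b) m 0 (λ ()))
  (sym (trans (mono-⊛ 0 1 (mono a b) m 0) (guard-zero (0 ≤? m) (λ _ → refl))))
mono-suc-q a b m (suc n) = trans
  ([]-cong ((m ℕₚ.≟ a) ×-dec (suc n ℕₚ.≟ suc b)) ((m ℕₚ.≟ a) ×-dec (n ℕₚ.≟ b))
           (λ (m≡a , n≡b) → m≡a , ℕₚ.suc-injective n≡b) (λ (m≡a , n≡b) → m≡a , cong suc n≡b))
  (sym (mono-⊛ 0 1 (mono a b) m (suc n)))

mono≐z^q^ : ∀ a b → mono a b ≐ z ^ a ⊛ q ^ b
mono≐z^q^ zero b = ≐-trans (mono-q^ b) (≐-sym (⊛-identityˡ (q ^ b)))
  where
  mono-q^ : ∀ b → mono 0 b ≐ q ^ b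
  mono-q^ zero = ≐-refl
  mono-q^ (suc b) = ≐-trans (mono-suc-q 0 b) (⊛-cong (≐-refl {q}) (mono-q^ b))
mono≐z^q^ (suc a) b = ≐-trans (mono-suc-z a b)
  (≐-trans (⊛-cong (≐-refl {z}) (mono≐z^q^ a b)) (≐-sym (⊛-assoc z (z ^ a) (q ^ b))))

σ-relation : ∀ {F A B} a b → F ≐ mono a b ⊛ A ⊞ B → σ F ≐ mono a (a + b) ⊛ σ A ⊞ σ B
σ-relation {F} {A} {B} a b F≐ m n = begin
  σ F m n                                          ≡⟨ σ-cong F≐ m n ⟩
  σ (mono a b ⊛ A ⊞ B) m n                         ≡⟨ σ-⊞ (mono a b ⊛ A) B m n ⟩
  σ (mono a b ⊛ A) m n ℤ.+ σ B m n                 ≡⟨ cong (ℤ._+ σ B m n) (σ-⊛ (mono a b) A m n) ⟩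
  (σ (mono a b) ⊛ σ A) m n ℤ.+ σ B m n             ≡⟨ cong (ℤ._+ σ B m n) (⊛-cong (σ-mono a b) (≐-refl {σ A}) m n) ⟩
  (mono a (a + b) ⊛ σ A) m n ℤ.+ σ B m n           ∎

monomial-form : ∀ {F A B} a b → F ≐ mono a b ⊛ A ⊞ B → F ≐ (z ^ a ⊛ q ^ b) ⊛ A ⊞ B
monomial-form {F} {A} {B} a b F≐ = ≐-trans F≐ (⊞-cong (⊛-cong (mono≐z^q^ a b) (≐-refl {A})) (≐-refl {B}))

G X Y U V : Series
G = GF 2 0
X = GF 0 2
Y = GF 0 1
U = GF 1 0
V = GF 0 0

G-relation : G ≐ mono 1 2 ⊛ X ⊞ σ G
G-relation = ≐-trans (GF-head 2 0)
  (⊞-cong (≐-refl {mono 1 2 ⊛ X}) (≐-trans (GF-≤∸2 {3} {0} {1} z≤n (s≤s z≤n)) (GF-shift 2 0)))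

X-relation : X ≐ mono 1 0 ⊛ G ⊞ σ Y
X-relation = ≐-trans (GF-head 0 2) (⊞-cong (≐-refl {mono 1 0 ⊛ G}) (GF-shift 0 1))

Y-relation : Y ≐ mono 1 0 ⊛ U ⊞ σ V
Y-relation = ≐-trans (GF-head 0 1) (⊞-cong (≐-refl {mono 1 0 ⊛ U}) (GF-shift 0 0))

U-relation : U ≐ mono 1 1 ⊛ Y ⊞ G
U-relation = GF-head 1 0

V-relation : V ≐ mono 1 0 ⊛ V ⊞ U
V-relation = GF-head 0 0

oneMinus≐ : ∀ a b → oneMinus a b ≐ 𝟙 ⊞ ⊟ (z ^ a ⊛ q ^ b)
oneMinus≐ a b m n = cong (λ x → 𝟙 m n ℤ.- x) (mono≐z^q^ a b m n)

G-σ-equation : leftCoeff ⊛ G ≐ rightCoeff ⊛ σ G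
G-σ-equation = ≐-trans (⊛-cong (⊛-cong (⊛-cong (oneMinus≐ 1 2) (oneMinus≐ 2 2)) (oneMinus≐ 2 3)) (≐-refl {G}))
  (≐-trans (relations⇒σ-equation z q G X (σ G) (σ X) (σ Y) (σ U) (σ² G) (σ² Y) (σ² U) (σ² V)
             (monomial-form {G} {X} {σ G} 1 2 G-relation)
             (monomial-form {X} {G} {σ Y} 1 0 X-relation)
             (monomial-form {σ Y} {σ U} {σ² V} 1 1 (σ-relation {Y} {U} {σ V} 1 0 Y-relation))
             (monomial-form {σ U} {σ Y} {σ G} 1 2 (σ-relation {U} {Y} {G} 1 1 U-relation))
             (monomial-form {σ² V} {σ² V} {σ² U} 1 2
               (σ-relation {σ V} {σ V} {σ U} 1 1 (σ-relation {V} {V} {U} 1 0 V-relation)))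
             (monomial-form {σ² U} {σ² Y} {σ² G} 1 3
               (σ-relation {σ U} {σ Y} {σ G} 1 2 (σ-relation {U} {Y} {G} 1 1 U-relation)))
             (monomial-form {σ G} {σ X} {σ² G} 1 3 (σ-relation {G} {X} {σ G} 1 2 G-relation))
             (monomial-form {σ X} {σ G} {σ² Y} 1 1 (σ-relation {X} {G} {σ Y} 1 0 X-relation)))
           (⊛-cong (≐-sym (oneMinus≐ 3 6)) (≐-refl {σ G})))
  where
  σ² : Series → Series
  σ² f = σ (σ f)

G≡rhsTrunc : ∀ N m n → n ≤ N → G m n ≡ rhsTrunc N m n
G≡rhsTrunc N m n n≤N = ℤₚ.i-j≡0⇒i≡j (G m n) (P m n)
  (σ-equation-unique leftCoeff rightCoeff N (G ⊞ ⊟ P) leftCoeff-rowUnit rightCoeff-rowUnit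
                     agree-on-row0 difference-equation m n n≤N)
  where
  P : Series
  P = rhsTrunc N
  agree-on-row0 : ∀ n → n ≤ N → G 0 n ℤ.- P 0 n ≡ 0ℤ
  agree-on-row0 n _ = trans (cong₂ ℤ._-_ (GF-length0 2 0 n) (rhsTrunc-rowUnit N n)) (ℤₚ.+-inverseʳ (𝟙 0 n))
  difference-equation : ∀ m n → n ≤ N → (leftCoeff ⊛ (G ⊞ ⊟ P)) m n ≡ (rightCoeff ⊛ σ (G ⊞ ⊟ P)) m n
  difference-equation m n n≤N = begin
    (leftCoeff ⊛ (G ⊞ ⊟ P)) m n
      ≡⟨ ⊛-distribˡ leftCoeff G (⊟ P) m n ⟩
    (leftCoeff ⊛ G) m n ℤ.+ (leftCoeff ⊛ ⊟ P) m n
      ≡⟨ cong₂ ℤ._+_ (G-σ-equation m n) (trans (⊛-negʳ leftCoeff P m n) (cong ℤ.-_ (rhsTrunc-σ-equation≤ N m n n≤N))) ⟩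
    (rightCoeff ⊛ σ G) m n ℤ.- (rightCoeff ⊛ σ P) m n
      ≡⟨ cong (ℤ._+_ ((rightCoeff ⊛ σ G) m n)) (⊛-negʳ rightCoeff (σ P) m n) ⟨
    (rightCoeff ⊛ σ G) m n ℤ.+ (rightCoeff ⊛ ⊟ σ P) m n
      ≡⟨ ⊛-distribˡ rightCoeff (σ G) (⊟ σ P) m n ⟨
    (rightCoeff ⊛ (σ G ⊞ ⊟ σ P)) m n
      ≡⟨ ⊛-cong (≐-refl {rightCoeff}) (≐-sym (≐-trans (σ-⊞ G (⊟ P)) (⊞-cong (≐-refl {σ G}) (σ-⊟ P)))) m n ⟩
    (rightCoeff ⊛ σ (G ⊞ ⊟ P)) m n ∎

theorem21 : (m n N : ℕ) → n ≤ N →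
    Σ[ k ∈ ℕ ] ((Fin k ↔ Part02 m n) × (+ k ≡ rhsTrunc N m n))
theorem21 m n N n≤N =
  count 2 0 m n , ↔-trans (enum (revPart-finite m 2 0 n)) (↔-sym (Part02↔RevPart m n)) , G≡rhsTrunc N m n n≤N
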